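{- Let $G$ be an (unrooted) graph with edge set $E$ and let $k\ge1$ be an integer. Let $G_k$ be the $k$-stretch of $G$. Then the number of subtrees of $G_k$ is \[t(G_k)=\left(\sum_{i,j\ge0}t_{i,j}(G)\,k^i\binom{k+1}{2}^{j}\right)+\frac{k(k-1)|E|}{2}.\]
   Context: Graphs may have loops and multiple edges. A subtree of $G$ is a subgraph of $G$ (not necessarily induced, with at least one vertex) that is a tree; $t(G)$ denotes the number of subtrees of $G$. For a subtree $T$, an edge of $G$ is external if it is not in $E(T)$; $t_{i,j}(G)$ is the number of subtrees of $G$ having exactly $i$ external edges with precisely one endvertex in $T$ and exactly $j$ external edges with both endvertices in $T$ (a loop at a vertex of $T$ counts as having both endvertices in $T$). The $k$-stretch $G_k$ is obtained from $G$ by replacing every non-loop edge by a path with $k$ edges and every loop by a circuit with $k$ edges (introducing new internal vertices). -}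

module Defs where

open import Data.Nat using (ℕ; zero; suc; _+_; _*_; _∸_; _<?_)
open import Data.Bool using (Bool; true; false; not; _∧_; _xor_)
open import Data.Fin using (Fin; zero; suc; toℕ; fromℕ<; inject₁; _↑ˡ_; _↑ʳ_; remQuot; combine)
open import Data.Fin.Subset using (Subset; _∈_; _∉_; _-_; ∣_∣)
open import Data.Vec using (Vec; lookup; tabulate)
open import Data.Product using (Σ; ∃; _×_; _,_; proj₁; proj₂)
open import Data.Sum using (_⊎_)
open import Relation.Nullary using (¬_; yes; no)
open import Relation.Binary.PropositionalEquality using (_≡_)
open import Function.Definitions using (Injective)

-- Finite multigraphs (loops and multiple edges allowed):
-- vertices Fin n, edges Fin m, each edge has an (unordered) pair of
-- endvertices, recorded as an ordered pair; a loop has equal ends.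

record Graph (n m : ℕ) : Set where
  field
    ends : Fin m → Fin n × Fin n

open Graph public

module _ {n m : ℕ} (G : Graph n m) where

  Joins : Fin m → Fin n → Fin n → Set
  Joins e x y = (ends G e ≡ (x , y)) ⊎ (ends G e ≡ (y , x))

  data Conn (F : Subset m) : Fin n → Fin n → Set where
    here : ∀ {x} → Conn F x x
    step : ∀ {x y z} (e : Fin m) → e ∈ F → Joins e x y → Conn F y z → Conn F x z

  IsSubgraph : Subset n → Subset m → Set
  IsSubgraph S F = ∀ e → e ∈ F → (proj₁ (ends G e) ∈ S) × (proj₂ (ends G e) ∈ S)

  -- Acyclic: no edge of F lies on a cycle of (S , F), i.e. for each
  -- edge e of F its endvertices are not joined by a walk in F ∖ {e}
  -- (this excludes loops and parallel edges as well).
  IsSubtree : Subset n × Subset m → Set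
  IsSubtree (S , F) =
    IsSubgraph S F
    × (∃ λ x → x ∈ S)
    × (∀ x y → x ∈ S → y ∈ S → Conn F x y)
    × (∀ e → e ∈ F → ¬ Conn (F - e) (proj₁ (ends G e)) (proj₂ (ends G e)))

  extOne : Subset n × Subset m → ℕ
  extOne (S , F) = ∣ tabulate (λ e → not (lookup F e) ∧
                      (lookup S (proj₁ (ends G e)) xor lookup S (proj₂ (ends G e)))) ∣

  extBoth : Subset n × Subset m → ℕ
  extBoth (S , F) = ∣ tabulate (λ e → not (lookup F e) ∧
                      (lookup S (proj₁ (ends G e)) ∧ lookup S (proj₂ (ends G e)))) ∣

  IsSubtree[_,_] : ℕ → ℕ → Subset n × Subset m → Set
  IsSubtree[ i , j ] T = IsSubtree T × (extOne T ≡ i) × (extBoth T ≡ j)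

record Count {A : Set} (P : A → Set) (N : ℕ) : Set where
  field
    enum     : Fin N → A
    injective : Injective _≡_ _≡_ enum
    sound    : ∀ i → P (enum i)
    complete : ∀ x → P x → ∃ λ i → enum i ≡ x

-- Vertices: the n old ones, plus k ∸ 1 new internal vertices
-- per edge.  Edge e with ends (u , v) becomes the walk
-- u = w₀ , w₁ , … , w_{k-1} , w_k = v  (a circuit of length k if u = v),
-- its s-th edge (s < k) joining w_s and w_{s+1}.

module _ {n m : ℕ} (G : Graph n m) (k : ℕ) where

  pathVertex : Fin m → Fin (suc k) → Fin (n + m * (k ∸ 1))
  pathVertex e zero = proj₁ (ends G e) ↑ˡ (m * (k ∸ 1))
  pathVertex e (suc j) with toℕ j <? k ∸ 1
  ... | yes p = n ↑ʳ combine e (fromℕ< p)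
  ... | no _  = proj₂ (ends G e) ↑ˡ (m * (k ∸ 1))

  stretch : Graph (n + m * (k ∸ 1)) (m * k)
  ends stretch x with remQuot k x
  ... | (e , s) = pathVertex e (inject₁ s) , pathVertex e (suc s)

Σ< : ℕ → (ℕ → ℕ) → ℕ
Σ< zero f = 0
Σ< (suc n) f = Σ< n f + f n

-- A subtree of the k-stretch either contains an original vertex of G or lies inside the path replacing
-- a single edge.  In the first case its original vertices and the edges of G whose whole path it contains
-- form a subtree T of G (walks in the stretch project to walks in G, and cycles of G lift back), and the
-- subtree is T stretched plus, on the path of every external edge of T, the edges before some position a
-- and from some position d on, with a < d ≤ k: the pair (a , d) is free (binom(k+1,2) choices) when both
-- ends lie in T, one of them is fixed (k choices) when one end does, and both are (a = 0 , d = k) otherwise.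
-- In the second case it is a nonempty subpath of the interior of one path, which gives binom(k,2) = k(k-1)/2
-- subtrees for each edge of G.
module Submission where

open import Defs
open import Data.Nat using (ℕ; zero; suc; _+_; _*_; _∸_; _^_; _≤_; _<_; z≤n; s≤s; _<?_; _≤?_)
open import Data.Nat.Properties
open import Data.Nat.DivMod using (_/_; m*n/n≡m)
open import Data.Nat.Combinatorics using (_C_; nCk+nC[k+1]≡[n+1]C[k+1]; nC1≡n)
open import Data.Nat.Solver using (module +-*-Solver)
open import Algebra.Properties.CommutativeSemigroup *-commutativeSemigroup using (x∙yz≈y∙xz)
open import Data.Bool using (Bool; true; false; not; _∧_; _xor_)
open import Data.Fin as Fin using (Fin; zero; suc; toℕ; fromℕ<; splitAt; join; _↑ˡ_; _↑ʳ_; combine; remQuot; inject₁)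
open import Data.Fin.Properties
  using (injective⇒≤; splitAt-↑ˡ; splitAt-↑ʳ; join-splitAt; remQuot-combine; combine-remQuot; toℕ-injective; toℕ<n;
         toℕ-fromℕ<; fromℕ<-toℕ; toℕ-inject₁; ↑ˡ-injective; ↑ʳ-injective; toℕ-↑ˡ; toℕ-↑ʳ; splitAt⁻¹-↑ˡ; splitAt⁻¹-↑ʳ;
         combine-injectiveˡ; combine-injectiveʳ; any?)
open import Data.Fin.Subset using (Subset; _∈_; _∉_; _⊆_; _-_; _─_; ⁅_⁆; ∣_∣)
open import Data.Fin.Subset.Properties using (_∈?_; ∣p∣≤n; x∈p∧x≢y⇒x∈p-y; p─q⊆p; x∈⁅x⁆; ⊆-antisym)
open import Data.Vec using (Vec; []; _∷_; lookup; tabulate)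
open import Data.Vec.Properties using (lookup∘tabulate; tabulate∘lookup; tabulate-cong; []=⇒lookup; lookup⇒[]=)
open import Data.Product using (Σ; ∃; _×_; _,_; proj₁; proj₂; uncurry′)
open import Data.Sum using (_⊎_; inj₁; inj₂; [_,_]′; map₁; map₂)
open import Data.Sum.Properties using (inj₁-injective; inj₂-injective)
open import Data.Unit using (⊤; tt)
open import Function using (_∘_)
open import Function.Definitions using (Injective)
open import Relation.Nullary using (¬_; yes; no; Dec; does; contradiction)
open import Relation.Nullary.Decidable using (dec-true; _⊎-dec_; _×-dec_)
open import Relation.Binary using (tri<; tri≈; tri>)
open import Relation.Binary.PropositionalEquality

open Count

count-unique : ∀ {A : Set} {P : A → Set} {N M} → Count P N → Count P M → N ≡ M
count-unique {P = P} c d = ≤-antisym (injective⇒≤ (reindex-injective c d)) (injective⇒≤ (reindex-injective d c))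
  where
  reindex : ∀ {N M} → Count P N → Count P M → Fin N → Fin M
  reindex c d i = proj₁ (complete d (enum c i) (sound c i))
  reindex-injective : ∀ {N M} (c : Count P N) (d : Count P M) → Injective _≡_ _≡_ (reindex c d)
  reindex-injective c d {i} {j} eq = injective c (begin
    enum c i                  ≡⟨ sym (proj₂ (complete d (enum c i) (sound c i))) ⟩
    enum d (reindex c d i)    ≡⟨ cong (enum d) eq ⟩
    enum d (reindex c d j)    ≡⟨ proj₂ (complete d (enum c j) (sound c j)) ⟩
    enum c j                  ∎)
    where open ≡-Reasoning

count-map : ∀ {A B : Set} {P : A → Set} {Q : B → Set} {N} (f : A → B) → Count P N →
  (∀ a → P a → Q (f a)) → (∀ a a' → P a → P a' → f a ≡ f a' → a ≡ a') →
  (∀ b → Q b → Σ A λ a → P a × f a ≡ b) → Count Q N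
count-map f c f-sound f-injective f-onto = record
  { enum      = λ i → f (enum c i)
  ; injective = λ {i} {j} eq → injective c (f-injective _ _ (sound c i) (sound c j) eq)
  ; sound     = λ i → f-sound _ (sound c i)
  ; complete  = λ b q → let (a , pa , fa≡b) = f-onto b q ; (i , eᵢ) = complete c a pa
                        in i , trans (cong f eᵢ) fa≡b }

count-⇔ : ∀ {A : Set} {P Q : A → Set} {N} → Count P N → (∀ a → P a → Q a) → (∀ a → Q a → P a) → Count Q N
count-⇔ c to from = count-map (λ a → a) c to (λ _ _ _ _ eq → eq) (λ b q → b , from b q , refl)

count-none : ∀ {A : Set} {P : A → Set} → (∀ a → ¬ P a) → Count P 0
count-none ¬P = record { enum = λ () ; injective = λ { {()} } ; sound = λ () ; complete = λ a p → contradiction p (¬P a) }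

count-one : ∀ {A : Set} {P : A → Set} (a₀ : A) → P a₀ → (∀ a → P a → a ≡ a₀) → Count P 1
count-one a₀ pa₀ unique = record
  { enum = λ _ → a₀ ; injective = λ { {zero} {zero} _ → refl } ; sound = λ _ → pa₀
  ; complete = λ a pa → zero , sym (unique a pa) }

count-< : ∀ N → Count (_< N) N
count-< N = record { enum = toℕ ; injective = toℕ-injective ; sound = toℕ<n
                   ; complete = λ a a<N → fromℕ< a<N , toℕ-fromℕ< a<N }

count-Fin : ∀ N → Count (λ (_ : Fin N) → ⊤) N
count-Fin N = record { enum = λ i → i ; injective = λ eq → eq ; sound = λ _ → tt ; complete = λ a _ → a , refl }

count-⊎ : ∀ {A B : Set} {P : A → Set} {Q : B → Set} {N M} → Count P N → Count Q M → Count [ P , Q ]′ (N + M)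
count-⊎ {P = P} {Q} {N} {M} c d = record
  { enum = enum′ ∘ splitAt N ; injective = injective′ ; sound = sound′ ∘ splitAt N ; complete = complete′ }
  where
  enum′ : Fin N ⊎ Fin M → _
  enum′ = [ inj₁ ∘ enum c , inj₂ ∘ enum d ]′
  enum′-injective : ∀ x y → enum′ x ≡ enum′ y → x ≡ y
  enum′-injective (inj₁ i) (inj₁ j) eq = cong inj₁ (injective c (inj₁-injective eq))
  enum′-injective (inj₂ i) (inj₂ j) eq = cong inj₂ (injective d (inj₂-injective eq))
  injective′ : Injective _≡_ _≡_ (enum′ ∘ splitAt N)
  injective′ {i} {j} eq = begin
    i                         ≡⟨ sym (join-splitAt N M i) ⟩
    join N M (splitAt N i)    ≡⟨ cong (join N M) (enum′-injective (splitAt N i) (splitAt N j) eq) ⟩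
    join N M (splitAt N j)    ≡⟨ join-splitAt N M j ⟩
    j                         ∎
    where open ≡-Reasoning
  sound′ : ∀ x → [ P , Q ]′ (enum′ x)
  sound′ (inj₁ i) = sound c i
  sound′ (inj₂ j) = sound d j
  complete′ : ∀ x → [ P , Q ]′ x → ∃ λ i → enum′ (splitAt N i) ≡ x
  complete′ (inj₁ a) pa = let (i , eq) = complete c a pa
                          in i ↑ˡ M , trans (cong enum′ (splitAt-↑ˡ N i M)) (cong inj₁ eq)
  complete′ (inj₂ b) qb = let (j , eq) = complete d b qb
                          in N ↑ʳ j , trans (cong enum′ (splitAt-↑ʳ N M j)) (cong inj₂ eq)

count-∪ : ∀ {A : Set} {P Q : A → Set} {N M} → Count P N → Count Q M → (∀ a → P a → ¬ Q a) →
  Count (λ a → P a ⊎ Q a) (N + M)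
count-∪ {P = P} {Q} c d disjoint = count-map [ (λ a → a) , (λ a → a) ]′ (count-⊎ c d) sound′ injective′ onto
  where
  sound′ : ∀ x → [ P , Q ]′ x → _
  sound′ (inj₁ a) pa = inj₁ pa
  sound′ (inj₂ a) qa = inj₂ qa
  injective′ : ∀ x y → [ P , Q ]′ x → [ P , Q ]′ y → _ → x ≡ y
  injective′ (inj₁ a) (inj₁ b) _  _  eq   = cong inj₁ eq
  injective′ (inj₂ a) (inj₂ b) _  _  eq   = cong inj₂ eq
  injective′ (inj₁ a) (inj₂ b) pa qb refl = contradiction qb (disjoint a pa)
  injective′ (inj₂ a) (inj₁ b) qa pb refl = contradiction qa (disjoint a pb)
  onto : ∀ b → P b ⊎ Q b → _
  onto b (inj₁ pb) = inj₁ b , pb , refl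
  onto b (inj₂ qb) = inj₂ b , qb , refl

count-Σ : ∀ {A B : Set} {P : A → Set} {Q : A → B → Set} {N M} → Count P N → (∀ a → P a → Count (Q a) M) →
  Count (λ (x : A × B) → P (proj₁ x) × Q (proj₁ x) (proj₂ x)) (N * M)
count-Σ {A} {B} {P} {Q} {N} {M} c fibre = record
  { enum = enum′ ∘ remQuot M ; injective = injective′ ; complete = complete′
  ; sound = λ _ → sound c _ , sound (fibre _ _) _ }
  where
  enum′ : Fin N × Fin M → A × B
  enum′ (i , j) = enum c i , enum (fibre (enum c i) (sound c i)) j
  enum′-injective : ∀ x y → enum′ x ≡ enum′ y → x ≡ y
  enum′-injective (i , j) (i′ , j′) eq with injective c (cong proj₁ eq)
  ... | refl = cong (i ,_) (injective (fibre (enum c i) (sound c i)) (cong proj₂ eq))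
  injective′ : Injective _≡_ _≡_ (enum′ ∘ remQuot M)
  injective′ {x} {y} eq = begin
    x                                   ≡⟨ sym (combine-remQuot {N} M x) ⟩
    uncurry′ combine (remQuot {N} M x)  ≡⟨ cong (uncurry′ combine) (enum′-injective _ _ eq) ⟩
    uncurry′ combine (remQuot {N} M y)  ≡⟨ combine-remQuot {N} M y ⟩
    y                                   ∎
    where open ≡-Reasoning
  complete′ : ∀ x → P (proj₁ x) × Q (proj₁ x) (proj₂ x) → ∃ λ i → enum′ (remQuot M i) ≡ x
  complete′ (a , b) (pa , qab) with complete c a pa
  ... | i , refl with complete (fibre (enum c i) (sound c i)) b qab
  ... | j , eq = combine i j , trans (cong enum′ (remQuot-combine i j)) (cong (enum c i ,_) eq)

count-⋃< : ∀ {A : Set} (P : ℕ → A → Set) (c : ℕ → ℕ) → (∀ i → Count (P i) (c i)) →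
  (∀ i j a → P i a → P j a → i ≡ j) → ∀ N → Count (λ a → Σ ℕ λ i → i < N × P i a) (Σ< N c)
count-⋃< P c count-P disjoint zero = count-none λ { a (i , () , _) }
count-⋃< P c count-P disjoint (suc N) =
  count-⇔ (count-∪ (count-⋃< P c count-P disjoint N) (count-P N)
                   (λ { a (i , i<N , pa) pNa → <-irrefl (disjoint i N a pa pNa) i<N }))
    (λ { a (inj₁ (i , i<N , pa)) → i , m<n⇒m<1+n i<N , pa ; a (inj₂ pNa) → N , n<1+n N , pNa })
    (λ { a (i , i<1+N , pa) → split i<1+N pa })
  where
  split : ∀ {i a} → i < suc N → P i a → (Σ ℕ λ i → i < N × P i a) ⊎ P N a
  split {i} i<1+N pa with m≤n⇒m<n∨m≡n (≤-pred i<1+N)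
  ... | inj₁ i<N  = inj₁ (i , i<N , pa)
  ... | inj₂ refl = inj₂ pa

∏ : ∀ {m} → (Fin m → ℕ) → ℕ
∏ {zero}  f = 1
∏ {suc m} f = f zero * ∏ (f ∘ suc)

count-Vec : ∀ {B : Set} {m} (Q : Fin m → B → Set) (N : Fin m → ℕ) → (∀ e → Count (Q e) (N e)) →
  Count (λ (c : Vec B m) → ∀ e → Q e (lookup c e)) (∏ N)
count-Vec {m = zero} Q N count-Q = count-one [] (λ ()) (λ { [] _ → refl })
count-Vec {m = suc m} Q N count-Q =
  count-map (uncurry′ _∷_)
    (count-Σ {Q = λ _ c → ∀ e → Q (suc e) (lookup c e)} (count-Q zero)
             (λ _ _ → count-Vec (Q ∘ suc) (N ∘ suc) (count-Q ∘ suc)))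
    (λ { (x , c) (qx , qc) → λ { zero → qx ; (suc e) → qc e } })
    (λ { (x , c) (x′ , c′) _ _ refl → refl })
    (λ { (x ∷ c) q → (x , c) , (q zero , q ∘ suc) , refl })

first-failure : (P : ℕ → Set) → (∀ s → Dec (P s)) → ∀ t u →
  (∀ s → t ≤ s → s < u → P s)
  ⊎ (Σ ℕ λ s → t ≤ s × s < u × ¬ P s × (∀ s′ → t ≤ s′ → s′ < s → P s′))
first-failure P P? t zero = inj₁ λ _ _ ()
first-failure P P? t (suc u) with first-failure P P? t u
... | inj₂ (s , t≤s , s<u , ¬Ps , below) = inj₂ (s , t≤s , m<n⇒m<1+n s<u , ¬Ps , below)
... | inj₁ below with P? u
...   | yes Pu = inj₁ λ s t≤s s<1+u → [ below s t≤s , (λ { refl → Pu }) ]′ (m≤n⇒m<n∨m≡n (≤-pred s<1+u))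
...   | no ¬Pu with t ≤? u
...     | yes t≤u = inj₂ (u , t≤u , n<1+n u , ¬Pu , below)
...     | no t≰u  = inj₁ λ s t≤s s<1+u → contradiction (≤-trans t≤s (≤-pred s<1+u)) t≰u

last-failure : (P : ℕ → Set) → (∀ s → Dec (P s)) → ∀ t → (Σ ℕ λ s → s < t × ¬ P s) →
  Σ ℕ λ L → L < t × ¬ P L × (∀ s → L < s → s < t → P s)
last-failure P P? (suc t) (s , s<1+t , ¬Ps) with P? t
... | no ¬Pt = t , n<1+n t , ¬Pt , λ s′ t<s′ s′<1+t → contradiction (≤-pred s′<1+t) (<⇒≱ t<s′)
... | yes Pt with m≤n⇒m<n∨m≡n (≤-pred s<1+t)
...   | inj₂ refl = contradiction Pt ¬Ps
...   | inj₁ s<t with last-failure P P? t (s , s<t , ¬Ps)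
...     | L , L<t , ¬PL , above = L , m<n⇒m<1+n L<t , ¬PL , λ s′ L<s′ s′<1+t →
            [ above s′ L<s′ , (λ { refl → Pt }) ]′ (m≤n⇒m<n∨m≡n (≤-pred s′<1+t))

Σ<-cong : ∀ N {f g : ℕ → ℕ} → (∀ i → f i ≡ g i) → Σ< N f ≡ Σ< N g
Σ<-cong zero    f≗g = refl
Σ<-cong (suc N) f≗g = cong₂ _+_ (Σ<-cong N f≗g) (f≗g N)

Σ<-id : ∀ k → Σ< (suc k) (λ d → d) ≡ suc k C 2
Σ<-id zero    = refl
Σ<-id (suc k) = begin
  Σ< (suc k) (λ d → d) + suc k  ≡⟨ cong₂ _+_ (Σ<-id k) (sym (nC1≡n (suc k))) ⟩
  suc k C 2 + suc k C 1         ≡⟨ +-comm (suc k C 2) (suc k C 1) ⟩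
  suc k C 1 + suc k C 2         ≡⟨ nCk+nC[k+1]≡[n+1]C[k+1] (suc k) 1 ⟩
  suc (suc k) C 2               ∎
  where open ≡-Reasoning

double-Σ<-id : ∀ p → 2 * Σ< (suc p) (λ d → d) ≡ suc p * p
double-Σ<-id zero    = refl
double-Σ<-id (suc p) = begin
  2 * (Σ< (suc p) (λ d → d) + suc p)      ≡⟨ *-distribˡ-+ 2 (Σ< (suc p) (λ d → d)) (suc p) ⟩
  2 * Σ< (suc p) (λ d → d) + 2 * suc p    ≡⟨ cong (_+ 2 * suc p) (double-Σ<-id p) ⟩
  suc p * p + 2 * suc p                   ≡⟨ solve 1 (λ p → (con 1 :+ p) :* p :+ con 2 :* (con 1 :+ p)
                                                       := (con 2 :+ p) :* (con 1 :+ p)) refl p ⟩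
  suc (suc p) * suc p                     ∎
  where open ≡-Reasoning
        open +-*-Solver

half-[1+p]*p*m : ∀ p m → (suc p * p * m) / 2 ≡ m * (suc p C 2)
half-[1+p]*p*m p m = begin
  (suc p * p * m) / 2         ≡⟨ cong (λ x → x * m / 2) (sym (double-Σ<-id p)) ⟩
  (2 * Σp * m) / 2            ≡⟨ cong (_/ 2) (solve 2 (λ Σp m → con 2 :* Σp :* m := m :* Σp :* con 2) refl Σp m) ⟩
  (m * Σp * 2) / 2            ≡⟨ m*n/n≡m (m * Σp) 2 ⟩
  m * Σp                      ≡⟨ cong (m *_) (Σ<-id p) ⟩
  m * (suc p C 2)             ∎
  where open ≡-Reasoning
        open +-*-Solver
        Σp = Σ< (suc p) (λ d → d)

-- Cuts of a path with k edges

-- A cut (a , d) of the path replacing an edge e = uv keeps the path edges s < a (hanging from u)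
-- and s ≥ d (hanging from v).  An edge of the subtree is kept entirely; an external edge leaves a
-- nonempty gap a ≤ s < d, and a side can only be kept if its endvertex lies in the subtree.
PathCut : ℕ → (inTree uIn vIn : Bool) → ℕ × ℕ → Set
PathCut k true  uIn vIn (a , d) = a ≡ k × d ≡ k
PathCut k false uIn vIn (a , d) = a < d × d ≤ k × (uIn ≡ false → a ≡ 0) × (vIn ≡ false → d ≡ k)

KeptVertex KeptEdge : ℕ × ℕ → ℕ → Set
KeptVertex (a , d) t = t ≤ a ⊎ d ≤ t
KeptEdge   (a , d) s = s < a ⊎ d ≤ s

keptVertex? : ∀ ad t → Dec (KeptVertex ad t)
keptVertex? (a , d) t = (t ≤? a) ⊎-dec (d ≤? t)

keptEdge? : ∀ ad s → Dec (KeptEdge ad s)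
keptEdge? (a , d) s = (suc s ≤? a) ⊎-dec (d ≤? s)

gap-start-≤ : ∀ {k a d a′ d′} → a < d → d ≤ k →
  (∀ s → s < k → KeptEdge (a′ , d′) s → KeptEdge (a , d) s) → a′ ≤ a
gap-start-≤ {a = a} a<d d≤k ⊇ = ≮⇒≥ λ a<a′ →
  [ <-irrefl refl , <⇒≱ a<d ]′ (⊇ a (<-≤-trans a<d d≤k) (inj₁ a<a′))

gap-end-≤ : ∀ {k a d d′} → a < d → d′ ≤ k →
  (∀ s → s < k → KeptEdge (a , d) s → KeptEdge (a , d′) s) → d′ ≤ d
gap-end-≤ {d = d} a<d d′≤k ⊆ = ≮⇒≥ λ d<d′ →
  [ <-asym a<d , <⇒≱ d<d′ ]′ (⊆ d (<-≤-trans d<d′ d′≤k) (inj₂ ≤-refl))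

cut-unique : ∀ {k a d a′ d′} → a < d → d ≤ k → a′ < d′ → d′ ≤ k →
  (∀ s → s < k → KeptEdge (a , d) s → KeptEdge (a′ , d′) s) →
  (∀ s → s < k → KeptEdge (a′ , d′) s → KeptEdge (a , d) s) → (a , d) ≡ (a′ , d′)
cut-unique {a = a} a<d d≤k a′<d′ d′≤k ⊆ ⊇
  with ≤-antisym (gap-start-≤ a′<d′ d′≤k ⊆) (gap-start-≤ a<d d≤k ⊇)
... | refl = cong (a ,_) (≤-antisym (gap-end-≤ a′<d′ d≤k ⊇) (gap-end-≤ a<d d′≤k ⊆))

cutCount : (k c : ℕ) (inTree uIn vIn : Bool) → ℕ
cutCount k c true  uIn   vIn   = 1
cutCount k c false true  true  = c
cutCount k c false true  false = k
cutCount k c false false true  = k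
cutCount k c false false false = 1

count-gaps : ∀ k → Count (λ (p : ℕ × ℕ) → proj₁ p < proj₂ p × proj₂ p ≤ k) (suc k C 2)
count-gaps k = subst (Count _) (Σ<-id k) (count-⇔
  (count-⋃< (λ d p → proj₂ p ≡ d × proj₁ p < d) (λ d → d)
     (λ d → count-map (_, d) (count-< d) (λ a a<d → refl , a<d) (λ { a a′ _ _ refl → refl })
                       (λ { (a , d′) (refl , a<d) → a , a<d , refl }))
     (λ { i j p (refl , _) (refl , _) → refl }) (suc k))
  (λ { (a , d) (i , i<1+k , refl , a<d) → a<d , ≤-pred i<1+k })
  (λ { (a , d) (a<d , d≤k) → d , s≤s d≤k , refl , a<d }))

count-PathCut : ∀ k → 1 ≤ k → ∀ inTree uIn vIn →
  Count (PathCut k inTree uIn vIn) (cutCount k (suc k C 2) inTree uIn vIn)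
count-PathCut k 1≤k true uIn vIn = count-one (k , k) (refl , refl) (λ { _ (refl , refl) → refl })
count-PathCut k 1≤k false true true = count-⇔ (count-gaps k)
  (λ { (a , d) (a<d , d≤k) → a<d , d≤k , (λ ()) , (λ ()) })
  (λ { (a , d) (a<d , d≤k , _ , _) → a<d , d≤k })
count-PathCut k 1≤k false true false = count-map (_, k) (count-< k)
  (λ a a<k → a<k , ≤-refl , (λ ()) , (λ _ → refl))
  (λ { a a′ _ _ refl → refl })
  (λ { (a , d) (a<d , _ , _ , d≡k) → a , subst (a <_) (d≡k refl) a<d , cong (a ,_) (sym (d≡k refl)) })
count-PathCut k 1≤k false false true = count-map (λ d → 0 , suc d) (count-< k)
  (λ d d<k → s≤s z≤n , d<k , (λ _ → refl) , (λ ()))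
  (λ { a a′ _ _ refl → refl })
  (λ { (a , suc d) (_ , 1+d≤k , a≡0 , _) → d , 1+d≤k , cong (_, suc d) (sym (a≡0 refl))
     ; (a , zero) (() , _) })
count-PathCut k 1≤k false false false = count-one (0 , k) (1≤k , ≤-refl , (λ _ → refl) , (λ _ → refl))
  (λ { (a , d) (_ , _ , a≡0 , d≡k) → cong₂ _,_ (a≡0 refl) (d≡k refl) })

∏-cutCount : ∀ k c {m} (inTree uIn vIn : Fin m → Bool) →
  ∏ (λ e → cutCount k c (inTree e) (uIn e) (vIn e)) ≡
  k ^ ∣ tabulate (λ e → not (inTree e) ∧ (uIn e xor vIn e)) ∣
    * c ^ ∣ tabulate (λ e → not (inTree e) ∧ (uIn e ∧ vIn e)) ∣
∏-cutCount k c {zero} inTree uIn vIn = refl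
∏-cutCount k c {suc m} inTree uIn vIn
  with inTree zero | uIn zero | vIn zero | ∏-cutCount k c (inTree ∘ suc) (uIn ∘ suc) (vIn ∘ suc)
... | true  | _     | _     | ih = trans (+-identityʳ _) ih
... | false | true  | true  | ih =
  trans (cong (c *_) ih) (x∙yz≈y∙xz c (k ^ ∣ tabulate oneEnd ∣) (c ^ ∣ tabulate bothEnds ∣))
  where oneEnd bothEnds : Fin m → Bool
        oneEnd   e = not (inTree (suc e)) ∧ (uIn (suc e) xor vIn (suc e))
        bothEnds e = not (inTree (suc e)) ∧ (uIn (suc e) ∧ vIn (suc e))
... | false | true  | false | ih = trans (cong (k *_) ih) (sym (*-assoc k _ _))
... | false | false | true  | ih = trans (cong (k *_) ih) (sym (*-assoc k _ _))
... | false | false | false | ih = trans (+-identityʳ _) ih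

module _ {n m : ℕ} (G : Graph n m) where

  data Walk (A : Fin m → Set) : Fin n → Fin n → Set where
    nil  : ∀ {x} → Walk A x x
    cons : ∀ {x y z} e → A e → Joins G e x y → Walk A y z → Walk A x z

  Joins-sym : ∀ {e x y} → Joins G e x y → Joins G e y x
  Joins-sym (inj₁ eq) = inj₂ eq
  Joins-sym (inj₂ eq) = inj₁ eq

  walk-edge : ∀ {A x y} e → A e → Joins G e x y → Walk A x y
  walk-edge e a j = cons e a j nil

  walk-++ : ∀ {A x y z} → Walk A x y → Walk A y z → Walk A x z
  walk-++ nil            w′ = w′
  walk-++ (cons e a j w) w′ = cons e a j (walk-++ w w′)

  walk-reverse : ∀ {A x y} → Walk A x y → Walk A y x
  walk-reverse nil            = nil
  walk-reverse (cons e a j w) = walk-++ (walk-reverse w) (walk-edge e a (Joins-sym j))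

  walk-map : ∀ {A B x y} → (∀ e → A e → B e) → Walk A x y → Walk B x y
  walk-map f nil            = nil
  walk-map f (cons e a j w) = cons e (f e a) j (walk-map f w)

  walk-invariant : ∀ {A} (Z : Fin n → Set) → (∀ e x y → A e → Joins G e x y → Z x → Z y) →
    ∀ {x y} → Walk A x y → Z x → Z y
  walk-invariant Z preserve nil            zx = zx
  walk-invariant Z preserve (cons e a j w) zx = walk-invariant Z preserve w (preserve e _ _ a j zx)

  Conn⇒Walk : ∀ {F x y} → Conn G F x y → Walk (_∈ F) x y
  Conn⇒Walk here           = nil
  Conn⇒Walk (step e a j c) = cons e a j (Conn⇒Walk c)

  Walk⇒Conn : ∀ {F x y} → Walk (_∈ F) x y → Conn G F x y
  Walk⇒Conn nil            = here
  Walk⇒Conn (cons e a j w) = step e a j (Walk⇒Conn w)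

walk-simulate : ∀ {n₁ m₁ n₂ m₂} (H : Graph n₁ m₁) (G : Graph n₂ m₂) {A : Fin m₁ → Set} {B : Fin m₂ → Set}
  (R : Fin n₁ → Fin n₂ → Set) →
  (∀ g w y x → A g → Joins H g w y → R w x → Σ (Fin n₂) λ x′ → R y x′ × Walk G B x x′) →
  ∀ {w w′ x} → Walk H A w w′ → R w x → Σ (Fin n₂) λ x′ → R w′ x′ × Walk G B x x′
walk-simulate H G R simulate-step nil r = _ , r , nil
walk-simulate H G R simulate-step (cons g a j w) r =
  let (x₁ , r₁ , w₁) = simulate-step g _ _ _ a j r
      (x₂ , r₂ , w₂) = walk-simulate H G R simulate-step w r₁
  in x₂ , r₂ , walk-++ G w₁ w₂

∈⇒lookup≡true : ∀ {N} {S : Subset N} {x} → x ∈ S → lookup S x ≡ true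
∈⇒lookup≡true = []=⇒lookup

lookup≡true⇒∈ : ∀ {N} {S : Subset N} {x} → lookup S x ≡ true → x ∈ S
lookup≡true⇒∈ {S = S} {x} = lookup⇒[]= x S

∈-tabulate⁺ : ∀ {N} {f : Fin N → Bool} {x} → f x ≡ true → x ∈ tabulate f
∈-tabulate⁺ {f = f} {x} fx = lookup≡true⇒∈ (trans (lookup∘tabulate f x) fx)

∈-tabulate⁻ : ∀ {N} {f : Fin N → Bool} {x} → x ∈ tabulate f → f x ≡ true
∈-tabulate⁻ {f = f} {x} x∈ = trans (sym (lookup∘tabulate f x)) (∈⇒lookup≡true x∈)

x∈p-y⇒x∈p : ∀ {N} {p : Subset N} {y x} → x ∈ p - y → x ∈ p
x∈p-y⇒x∈p {p = p} {y} = p─q⊆p p ⁅ y ⁆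

x∈p-y⇒x≢y : ∀ {N} {p : Subset N} {y x} → x ∈ p - y → x ≢ y
x∈p-y⇒x≢y {p = p} {y} x∈ refl
  with trans (sym (∈⇒lookup≡true x∈)) (lookup-─ p ⁅ y ⁆ y (∈⇒lookup≡true (x∈⁅x⁆ y)))
  where
  lookup-─ : ∀ {N} (xs ys : Subset N) i → lookup ys i ≡ true → lookup (xs ─ ys) i ≡ false
  lookup-─ (x ∷ xs) (true ∷ ys) zero    _  = refl
  lookup-─ (x ∷ xs) (y ∷ ys)    (suc i) eq = lookup-─ xs ys i eq
... | ()

dec-true⁻ : ∀ {P : Set} (P? : Dec P) → does P? ≡ true → P
dec-true⁻ (yes p) _ = p

true-or-false : ∀ (b : Bool) → b ≡ true ⊎ b ≡ false
true-or-false true  = inj₁ refl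
true-or-false false = inj₂ refl

Vec-ext : ∀ {A : Set} {N} (xs ys : Vec A N) → (∀ i → lookup xs i ≡ lookup ys i) → xs ≡ ys
Vec-ext xs ys eq = trans (sym (tabulate∘lookup xs)) (trans (tabulate-cong eq) (tabulate∘lookup ys))

module Stretch {n m : ℕ} (G : Graph n m) (p : ℕ) where

  k : ℕ
  k = suc p

  H : Graph (n + m * p) (m * k)
  H = stretch G k

  V : Set
  V = Fin (n + m * p)

  u v : Fin m → Fin n
  u e = proj₁ (ends G e)
  v e = proj₂ (ends G e)

  orig : Fin n → V
  orig x = x ↑ˡ (m * p)

  inner : Fin m → Fin p → V
  inner e j = n ↑ʳ combine e j

  -- pathVertex with a natural-number index; positions t ≥ k all denote the endvertex v e
  vertexOn : Fin m → ℕ → V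
  vertexOn e zero = orig (u e)
  vertexOn e (suc t) with t <? p
  ... | yes t<p = inner e (fromℕ< t<p)
  ... | no _    = orig (v e)

  edgeOn : Fin m → (s : ℕ) → s < k → Fin (m * k)
  edgeOn e s s<k = combine e (fromℕ< s<k)

  pathVertex≡vertexOn : ∀ e (i : Fin (suc k)) → pathVertex G k e i ≡ vertexOn e (toℕ i)
  pathVertex≡vertexOn e zero = refl
  pathVertex≡vertexOn e (suc j) with toℕ j <? p
  ... | yes _ = refl
  ... | no _  = refl

  ends-edgeOn : ∀ e s (q : s < k) → ends H (edgeOn e s q) ≡ (vertexOn e s , vertexOn e (suc s))
  ends-edgeOn e s q = begin
    ends H (combine e (fromℕ< q))
      ≡⟨ cong (λ (f , r) → pathVertex G k f (inject₁ r) , pathVertex G k f (suc r))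
              (remQuot-combine {m} {k} e (fromℕ< q)) ⟩
    pathVertex G k e (inject₁ (fromℕ< q)) , pathVertex G k e (suc (fromℕ< q))
      ≡⟨ cong₂ _,_ (trans (pathVertex≡vertexOn e (inject₁ (fromℕ< q)))
                          (cong (vertexOn e) (toℕ-inject₁ (fromℕ< q))))
                   (pathVertex≡vertexOn e (suc (fromℕ< q))) ⟩
    vertexOn e (toℕ (fromℕ< q)) , vertexOn e (suc (toℕ (fromℕ< q)))
      ≡⟨ cong (λ t → vertexOn e t , vertexOn e (suc t)) (toℕ-fromℕ< q) ⟩
    vertexOn e s , vertexOn e (suc s)
      ∎
    where open ≡-Reasoning

  edge-view : ∀ g → Σ (Fin m) λ f → Σ ℕ λ s → Σ (s < k) λ q → g ≡ edgeOn f s q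
  edge-view g = let (f , r) = remQuot {m} k g in
    f , toℕ r , toℕ<n r , trans (sym (combine-remQuot {m} k g)) (cong (combine f) (sym (fromℕ<-toℕ r (toℕ<n r))))

  edgeOn-injective : ∀ {e f s t q r} → edgeOn e s q ≡ edgeOn f t r → e ≡ f × s ≡ t
  edgeOn-injective {e} {f} {s} {t} {q} {r} eq =
    combine-injectiveˡ e (fromℕ< q) f (fromℕ< r) eq ,
    trans (sym (toℕ-fromℕ< q)) (trans (cong toℕ (combine-injectiveʳ e (fromℕ< q) f (fromℕ< r) eq)) (toℕ-fromℕ< r))

  edgeOn-irrelevant : ∀ {e s q r} → edgeOn e s q ≡ edgeOn e s r
  edgeOn-irrelevant {e} {s} {q} {r} = cong (combine e) (toℕ-injective (trans (toℕ-fromℕ< q) (sym (toℕ-fromℕ< r))))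

  orig-injective : ∀ {x y} → orig x ≡ orig y → x ≡ y
  orig-injective = ↑ˡ-injective (m * p) _ _

  orig≢inner : ∀ {x e j} → orig x ≢ inner e j
  orig≢inner {x} {e} {j} eq = <⇒≢ (≤-trans (subst (_< n) (sym (toℕ-↑ˡ x (m * p))) (toℕ<n x)) (m≤m+n n _))
                                  (trans (cong toℕ eq) (toℕ-↑ʳ n (combine e j)))

  inner-injective : ∀ {e f i j} → inner e i ≡ inner f j → e ≡ f × i ≡ j
  inner-injective {e} {f} {i} {j} eq =
    combine-injectiveˡ e i f j (↑ʳ-injective n _ _ eq) , combine-injectiveʳ e i f j (↑ʳ-injective n _ _ eq)

  vertex-view : ∀ w → (Σ (Fin n) λ x → w ≡ orig x) ⊎ (Σ (Fin m) λ e → Σ (Fin p) λ j → w ≡ inner e j)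
  vertex-view w with splitAt n w in eq
  ... | inj₁ x = inj₁ (x , sym (splitAt⁻¹-↑ˡ eq))
  ... | inj₂ y = inj₂ (proj₁ (remQuot {m} p y) , proj₂ (remQuot {m} p y) ,
                       trans (sym (splitAt⁻¹-↑ʳ eq)) (cong (n ↑ʳ_) (sym (combine-remQuot {m} p y))))

  vertexOn-last : ∀ e t → p ≤ t → vertexOn e (suc t) ≡ orig (v e)
  vertexOn-last e t p≤t with t <? p
  ... | yes t<p = contradiction p≤t (<⇒≱ t<p)
  ... | no _    = refl

  vertexOn-k : ∀ {e} → vertexOn e k ≡ orig (v e)
  vertexOn-k {e} = vertexOn-last e p ≤-refl

  inner≡vertexOn : ∀ e j → inner e j ≡ vertexOn e (suc (toℕ j))
  inner≡vertexOn e j with toℕ j <? p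
  ... | yes j<p = cong (inner e) (sym (fromℕ<-toℕ j j<p))
  ... | no j≮p  = contradiction (toℕ<n j) j≮p

  vertexOn-view : ∀ e t → (t ≡ 0 × vertexOn e t ≡ orig (u e))
                        ⊎ (0 < t × t < k × Σ (Fin p) λ j → suc (toℕ j) ≡ t × vertexOn e t ≡ inner e j)
                        ⊎ (k ≤ t × vertexOn e t ≡ orig (v e))
  vertexOn-view e zero = inj₁ (refl , refl)
  vertexOn-view e (suc t) with t <? p
  ... | yes t<p = inj₂ (inj₁ (s≤s z≤n , s≤s t<p , fromℕ< t<p , cong suc (toℕ-fromℕ< t<p) , refl))
  ... | no t≮p  = inj₂ (inj₂ (s≤s (≮⇒≥ t≮p) , refl))

  vertexOn≡orig : ∀ {e t x} → vertexOn e t ≡ orig x → (t ≡ 0 × x ≡ u e) ⊎ (k ≤ t × x ≡ v e)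
  vertexOn≡orig {e} {t} eq with vertexOn-view e t
  ... | inj₁ (t≡0 , at-u)                 = inj₁ (t≡0 , orig-injective (trans (sym eq) at-u))
  ... | inj₂ (inj₁ (_ , _ , j , _ , at-j)) = contradiction (trans (sym eq) at-j) orig≢inner
  ... | inj₂ (inj₂ (k≤t , at-v))          = inj₂ (k≤t , orig-injective (trans (sym eq) at-v))

  vertexOn-injective : ∀ {f s e t} → 0 < t → t < k → vertexOn f s ≡ vertexOn e t → f ≡ e × s ≡ t
  vertexOn-injective {f} {s} {e} {t} 0<t t<k eq with vertexOn-view e t
  ... | inj₁ (refl , _)        = contradiction 0<t (<-irrefl refl)
  ... | inj₂ (inj₂ (k≤t , _))  = contradiction k≤t (<⇒≱ t<k)
  ... | inj₂ (inj₁ (_ , _ , j , 1+j≡t , at-j)) with vertexOn-view f s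
  ...   | inj₁ (_ , at-u)       = contradiction (trans (sym at-u) (trans eq at-j)) orig≢inner
  ...   | inj₂ (inj₂ (_ , at-v)) = contradiction (trans (sym at-v) (trans eq at-j)) orig≢inner
  ...   | inj₂ (inj₁ (_ , _ , i , 1+i≡s , at-i)) with inner-injective (trans (sym at-i) (trans eq at-j))
  ...     | refl , refl = refl , trans (sym 1+i≡s) 1+j≡t

  Interior : V → Fin m → ℕ → Set
  Interior w e t = 0 < t × t < k × w ≡ vertexOn e t

  Interior⇒≢orig : ∀ {w e t x} → Interior w e t → w ≢ orig x
  Interior⇒≢orig {e = e} {t} (0<t , t<k , refl) eq with vertexOn≡orig {e} {t} eq
  ... | inj₁ (t≡0 , _) = <-irrefl (sym t≡0) 0<t
  ... | inj₂ (k≤t , _) = contradiction k≤t (<⇒≱ t<k)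

  start-or-interior : ∀ e s → s < k → (s ≡ 0 × vertexOn e s ≡ orig (u e)) ⊎ Interior (vertexOn e s) e s
  start-or-interior e s s<k with vertexOn-view e s
  ... | inj₁ start                 = inj₁ start
  ... | inj₂ (inj₁ (0<s , _ , _))  = inj₂ (0<s , s<k , refl)
  ... | inj₂ (inj₂ (k≤s , _))      = contradiction k≤s (<⇒≱ s<k)

  interior-or-end : ∀ e s → s < k →
    Interior (vertexOn e (suc s)) e (suc s) ⊎ (k ≤ suc s × vertexOn e (suc s) ≡ orig (v e))
  interior-or-end e s s<k with vertexOn-view e (suc s)
  ... | inj₂ (inj₁ (0<1+s , 1+s<k , _)) = inj₁ (0<1+s , 1+s<k , refl)
  ... | inj₂ (inj₂ end)                = inj₂ end

  step-view : ∀ g {x y} → Joins H g x y →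
    Σ (Fin m) λ f → Σ ℕ λ s → Σ (s < k) λ q → g ≡ edgeOn f s q
      × ((x ≡ vertexOn f s × y ≡ vertexOn f (suc s)) ⊎ (x ≡ vertexOn f (suc s) × y ≡ vertexOn f s))
  step-view g j with edge-view g
  ... | f , s , q , refl with j
  ...   | inj₁ ends≡ = f , s , q , refl , inj₁ (cong proj₁ eq , cong proj₂ eq)
    where eq = trans (sym ends≡) (ends-edgeOn f s q)
  ...   | inj₂ ends≡ = f , s , q , refl , inj₂ (cong proj₂ eq , cong proj₁ eq)
    where eq = trans (sym ends≡) (ends-edgeOn f s q)

  Has : (Fin (m * k) → Set) → Fin m → ℕ → Set
  Has A e s = ∀ (q : s < k) → A (edgeOn e s q)

  HasBelow HasFrom : (Fin (m * k) → Set) → Fin m → ℕ → Set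
  HasBelow A e t = ∀ s → s < t → Has A e s
  HasFrom  A e t = ∀ s → t ≤ s → Has A e s

  HasAll : (Fin (m * k) → Set) → Fin m → Set
  HasAll A e = ∀ s → Has A e s

  has : ∀ (A : Fin (m * k) → Set) {e s} q → A (edgeOn e s q) → Has A e s
  has A {e} {s} q a q′ = subst A (edgeOn-irrelevant {e} {s} {q} {q′}) a

  HasBelow-suc : ∀ A {e t} → HasBelow A e t → Has A e t → HasBelow A e (suc t)
  HasBelow-suc A below at s s<1+t = [ below s , (λ { refl → at }) ]′ (m≤n⇒m<n∨m≡n (≤-pred s<1+t))

  HasBelow-pred : ∀ A {e t} → HasBelow A e (suc t) → HasBelow A e t
  HasBelow-pred A below s s<t = below s (m<n⇒m<1+n s<t)

  HasFrom-pred : ∀ A {e t} → HasFrom A e (suc t) → Has A e t → HasFrom A e t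
  HasFrom-pred A from at s t≤s = [ from s , (λ { refl → at }) ]′ (m≤n⇒m<n∨m≡n t≤s)

  HasFrom-suc : ∀ A {e t} → HasFrom A e t → HasFrom A e (suc t)
  HasFrom-suc A from s t<s = from s (<⇒≤ t<s)

  HasFrom-vacuous : ∀ A {e t} → k ≤ t → HasFrom A e t
  HasFrom-vacuous A k≤t s t≤s q = contradiction (≤-trans k≤t t≤s) (<⇒≱ q)

  HasBelow⇒HasAll : ∀ A {e t} → k ≤ t → HasBelow A e t → HasAll A e
  HasBelow⇒HasAll A k≤t below s q = below s (<-≤-trans q k≤t) q

  HasFrom⇒HasAll : ∀ A {e} → HasFrom A e 0 → HasAll A e
  HasFrom⇒HasAll A from s = from s z≤n

  Joins-ends : ∀ e → Joins G e (u e) (v e)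
  Joins-ends e = inj₁ refl

  Joins-edgeOn : ∀ e s q → Joins H (edgeOn e s q) (vertexOn e s) (vertexOn e (suc s))
  Joins-edgeOn e s q = inj₁ (ends-edgeOn e s q)

  -- An interior vertex of the path of e shadows the endvertex of e it is joined to through A along that path.
  Shadow : (Fin (m * k) → Set) → V → Fin n → Set
  Shadow A w x = w ≡ orig x
               ⊎ Σ (Fin m) λ e → Σ ℕ λ t → Interior w e t
                   × ((x ≡ u e × HasBelow A e t) ⊎ (x ≡ v e × HasFrom A e t))

  ShadowStep : (Fin (m * k) → Set) → V → Fin n → Set
  ShadowStep A y x = Σ (Fin n) λ x′ → Shadow A y x′ × Walk G (HasAll A) x x′

  up-from-orig : ∀ A {f s x} (q : s < k) → A (edgeOn f s q) → vertexOn f s ≡ orig x →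
    ShadowStep A (vertexOn f (suc s)) x
  up-from-orig A {f} {s} q a at-x with vertexOn≡orig {f} {s} at-x
  ... | inj₂ (k≤s , _) = contradiction k≤s (<⇒≱ q)
  ... | inj₁ (refl , refl) with interior-or-end f 0 q
  ...   | inj₁ int          = u f , inj₂ (f , 1 , int , inj₁ (refl , HasBelow-suc A (λ _ ()) (has A q a))) , nil
  ...   | inj₂ (k≤1 , at-v) = v f , inj₁ at-v ,
            walk-edge G f (HasBelow⇒HasAll A k≤1 (HasBelow-suc A (λ _ ()) (has A q a))) (Joins-ends f)

  down-from-orig : ∀ A {f s x} (q : s < k) → A (edgeOn f s q) → vertexOn f (suc s) ≡ orig x →
    ShadowStep A (vertexOn f s) x
  down-from-orig A {f} {s} q a at-x with vertexOn≡orig {f} {suc s} at-x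
  ... | inj₁ (() , _)
  ... | inj₂ (k≤1+s , refl) with start-or-interior f s q
  ...   | inj₁ (refl , at-u) = u f , inj₁ at-u ,
            walk-edge G f (HasFrom⇒HasAll A (HasFrom-pred A (HasFrom-vacuous A k≤1+s) (has A q a)))
                          (Joins-sym G (Joins-ends f))
  ...   | inj₂ int          =
            v f , inj₂ (f , s , int , inj₂ (refl , HasFrom-pred A (HasFrom-vacuous A k≤1+s) (has A q a))) , nil

  up-from-interior : ∀ A {f s x} (q : s < k) → A (edgeOn f s q) →
    (x ≡ u f × HasBelow A f s) ⊎ (x ≡ v f × HasFrom A f s) → ShadowStep A (vertexOn f (suc s)) x
  up-from-interior A {f} {s} q a (inj₁ (refl , below)) with interior-or-end f s q
  ... | inj₁ int            = u f , inj₂ (f , suc s , int , inj₁ (refl , HasBelow-suc A below (has A q a))) , nil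
  ... | inj₂ (k≤1+s , at-v) = v f , inj₁ at-v ,
          walk-edge G f (HasBelow⇒HasAll A k≤1+s (HasBelow-suc A below (has A q a))) (Joins-ends f)
  up-from-interior A {f} {s} q a (inj₂ (refl , from)) with interior-or-end f s q
  ... | inj₁ int            = v f , inj₂ (f , suc s , int , inj₂ (refl , HasFrom-suc A from)) , nil
  ... | inj₂ (_ , at-v)     = v f , inj₁ at-v , nil

  down-from-interior : ∀ A {f s x} (q : s < k) → A (edgeOn f s q) →
    (x ≡ u f × HasBelow A f (suc s)) ⊎ (x ≡ v f × HasFrom A f (suc s)) → ShadowStep A (vertexOn f s) x
  down-from-interior A {f} {s} q a (inj₁ (refl , below)) with start-or-interior f s q
  ... | inj₁ (refl , at-u) = u f , inj₁ at-u , nil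
  ... | inj₂ int           = u f , inj₂ (f , s , int , inj₁ (refl , HasBelow-pred A below)) , nil
  down-from-interior A {f} {s} q a (inj₂ (refl , from)) with start-or-interior f s q
  ... | inj₁ (refl , at-u) = u f , inj₁ at-u ,
          walk-edge G f (HasFrom⇒HasAll A (HasFrom-pred A from (has A q a))) (Joins-sym G (Joins-ends f))
  ... | inj₂ int           = v f , inj₂ (f , s , int , inj₂ (refl , HasFrom-pred A from (has A q a))) , nil

  shadow-step : ∀ A g w y x → A g → Joins H g w y → Shadow A w x → ShadowStep A y x
  shadow-step A g w y x a j shadow with step-view g j
  ... | f , s , q , refl , inj₁ (refl , refl) with shadow
  ...   | inj₁ at-x = up-from-orig A q a at-x
  ...   | inj₂ (e , t , (0<t , t<k , at) , side) with vertexOn-injective {f} {s} {e} {t} 0<t t<k at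
  ...     | refl , refl = up-from-interior A q a side
  shadow-step A g w y x a j shadow | f , s , q , refl , inj₂ (refl , refl) with shadow
  ...   | inj₁ at-x = down-from-orig A q a at-x
  ...   | inj₂ (e , t , (0<t , t<k , at) , side) with vertexOn-injective {f} {suc s} {e} {t} 0<t t<k at
  ...     | refl , refl = down-from-interior A q a side

  project : ∀ A {x y} → Walk H A (orig x) (orig y) → Walk G (HasAll A) x y
  project A w with walk-simulate H G (Shadow A) (shadow-step A) w (inj₁ refl)
  ... | x′ , inj₁ at-x′ , w′              = subst (Walk G (HasAll A) _) (sym (orig-injective at-x′)) w′
  ... | x′ , inj₂ (e , t , interior , _) , _ = contradiction refl (Interior⇒≢orig interior)

  walk-along : ∀ A e i j → i ≤ j → j ≤ k → (∀ s → i ≤ s → s < j → Has A e s) →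
    Walk H A (vertexOn e i) (vertexOn e j)
  walk-along A e i zero    z≤n      _     _   = nil
  walk-along A e i (suc j) i≤1+j 1+j≤k present with m≤n⇒m<n∨m≡n i≤1+j
  ... | inj₂ refl  = nil
  ... | inj₁ i<1+j = walk-++ H
          (walk-along A e i j (≤-pred i<1+j) (<⇒≤ 1+j≤k) (λ s i≤s s<j → present s i≤s (m<n⇒m<1+n s<j)))
          (walk-edge H (edgeOn e j 1+j≤k) (present j (≤-pred i<1+j) (n<1+n j) 1+j≤k) (Joins-edgeOn e j 1+j≤k))

  walk-path : ∀ A e → HasAll A e → Walk H A (orig (u e)) (orig (v e))
  walk-path A e all = subst (Walk H A (orig (u e))) vertexOn-k (walk-along A e 0 k z≤n ≤-refl (λ s _ _ → all s))

  lift : ∀ A (B : Fin m → Set) → (∀ f → B f → HasAll A f) → ∀ {x y} → Walk G B x y → Walk H A (orig x) (orig y)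
  lift A B B⇒all nil                       = nil
  lift A B B⇒all (cons f b (inj₁ refl) w) = walk-++ H (walk-path A f (B⇒all f b)) (lift A B B⇒all w)
  lift A B B⇒all (cons f b (inj₂ refl) w) = walk-++ H (walk-reverse H (walk-path A f (B⇒all f b))) (lift A B B⇒all w)

  Between : Fin m → ℕ → ℕ → V → Set
  Between e l h z = Σ ℕ λ t → l < t × t ≤ h × z ≡ vertexOn e t

  Between-invariant : ∀ (A : Fin (m * k) → Set) e l h → h < k →
    (∀ (q : l < k) → ¬ A (edgeOn e l q)) → (∀ (q : h < k) → ¬ A (edgeOn e h q)) →
    ∀ g z y → A g → Joins H g z y → Between e l h z → Between e l h y
  Between-invariant A e l h h<k ¬l ¬h g z y a j (t , l<t , t≤h , at) with step-view g j
  ... | f , s , q , refl , inj₁ (refl , refl)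
    with vertexOn-injective {f} {s} {e} {t} (≤-<-trans z≤n l<t) (≤-<-trans t≤h h<k) at
  ...   | refl , refl with m≤n⇒m<n∨m≡n t≤h
  ...     | inj₂ refl = contradiction a (¬h q)
  ...     | inj₁ t<h  = suc t , m<n⇒m<1+n l<t , t<h , refl
  Between-invariant A e l h h<k ¬l ¬h g z y a j (t , l<t , t≤h , at) | f , s , q , refl , inj₂ (refl , refl)
    with vertexOn-injective {f} {suc s} {e} {t} (≤-<-trans z≤n l<t) (≤-<-trans t≤h h<k) at
  ... | refl , refl with m≤n⇒m<n∨m≡n l<t
  ...   | inj₂ refl  = contradiction a (¬l q)
  ...   | inj₁ 1+l<t = s , ≤-pred 1+l<t , <⇒≤ t≤h , refl

  separated-from-below : ∀ (A : Fin (m * k) → Set) e s h → s < h → h < k →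
    (∀ (q : s < k) → ¬ A (edgeOn e s q)) → (∀ (q : h < k) → ¬ A (edgeOn e h q)) →
    ¬ Walk H A (vertexOn e s) (vertexOn e (suc s))
  separated-from-below A e s h s<h h<k ¬s ¬h w
    with walk-invariant H (Between e s h) (Between-invariant A e s h h<k ¬s ¬h) (walk-reverse H w) (suc s , ≤-refl , s<h , refl)
  ... | t , s<t , t≤h , at with vertexOn-injective {e} {s} {e} {t} (≤-<-trans z≤n s<t) (≤-<-trans t≤h h<k) at
  ...   | _ , refl = <-irrefl refl s<t

  separated-from-above : ∀ (A : Fin (m * k) → Set) e l s → l < s → s < k →
    (∀ (q : l < k) → ¬ A (edgeOn e l q)) → (∀ (q : s < k) → ¬ A (edgeOn e s q)) →
    ¬ Walk H A (vertexOn e s) (vertexOn e (suc s))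
  separated-from-above A e l s l<s s<k ¬l ¬s w
    with walk-invariant H (Between e l s) (Between-invariant A e l s s<k ¬l ¬s) w (s , l<s , ≤-refl , refl)
  ... | t , l<t , t≤s , at with vertexOn-injective {e} {suc s} {e} {t} (≤-<-trans z≤n l<t) (≤-<-trans t≤s s<k) at
  ...   | _ , refl = <-irrefl refl t≤s

  -- Subtrees through an original vertex

  vertexSet : (Fin n → Bool) → (Fin m → ℕ → Bool) → Subset (n + m * p)
  vertexSet onOrig onPath = tabulate ([ onOrig , (λ (e , j) → onPath e (suc (toℕ j))) ∘ remQuot {m} p ]′ ∘ splitAt n)

  edgeSet : (Fin m → ℕ → Bool) → Subset (m * k)
  edgeSet onPath = tabulate ((λ (e , r) → onPath e (toℕ r)) ∘ remQuot {m} k)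

  lookup-vertexSet-orig : ∀ onOrig onPath x → lookup (vertexSet onOrig onPath) (orig x) ≡ onOrig x
  lookup-vertexSet-orig onOrig onPath x =
    trans (lookup∘tabulate _ (orig x)) (cong [ onOrig , _ ]′ (splitAt-↑ˡ n x (m * p)))

  lookup-vertexSet-vertexOn : ∀ onOrig onPath e t → 0 < t → t < k →
    lookup (vertexSet onOrig onPath) (vertexOn e t) ≡ onPath e t
  lookup-vertexSet-vertexOn onOrig onPath e t 0<t t<k with vertexOn-view e t
  ... | inj₁ (refl , _)       = contradiction 0<t (<-irrefl refl)
  ... | inj₂ (inj₂ (k≤t , _)) = contradiction k≤t (<⇒≱ t<k)
  ... | inj₂ (inj₁ (_ , _ , j , refl , at-j)) = begin
    lookup (vertexSet onOrig onPath) (vertexOn e t)  ≡⟨ cong (lookup (vertexSet onOrig onPath)) at-j ⟩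
    lookup (vertexSet onOrig onPath) (inner e j)     ≡⟨ lookup∘tabulate _ (inner e j) ⟩
    [ onOrig , onInner ∘ remQuot {m} p ]′ (splitAt n (inner e j))
      ≡⟨ cong [ onOrig , onInner ∘ remQuot {m} p ]′ (splitAt-↑ʳ n (m * p) (combine e j)) ⟩
    onInner (remQuot {m} p (combine e j))            ≡⟨ cong onInner (remQuot-combine e j) ⟩
    onPath e t                                       ∎
    where open ≡-Reasoning
          onInner : Fin m × Fin p → Bool
          onInner (f , i) = onPath f (suc (toℕ i))

  lookup-edgeSet-edgeOn : ∀ onPath e s q → lookup (edgeSet onPath) (edgeOn e s q) ≡ onPath e s
  lookup-edgeSet-edgeOn onPath e s q = begin
    lookup (edgeSet onPath) (edgeOn e s q)                  ≡⟨ lookup∘tabulate _ (edgeOn e s q) ⟩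
    onEdge (remQuot {m} k (combine e (fromℕ< q)))           ≡⟨ cong onEdge (remQuot-combine e (fromℕ< q)) ⟩
    onPath e (toℕ (fromℕ< q))                               ≡⟨ cong (onPath e) (toℕ-fromℕ< q) ⟩
    onPath e s                                              ∎
    where open ≡-Reasoning
          onEdge : Fin m × Fin k → Bool
          onEdge (f , r) = onPath f (toℕ r)

  Cuts : Set
  Cuts = Vec (ℕ × ℕ) m

  cutA cutD : Cuts → Fin m → ℕ
  cutA c e = proj₁ (lookup c e)
  cutD c e = proj₂ (lookup c e)

  keepsVertex keepsEdge : Cuts → Fin m → ℕ → Bool
  keepsVertex c e t = does (keptVertex? (lookup c e) t)
  keepsEdge   c e s = does (keptEdge? (lookup c e) s)

  keptVertices : Subset n → Cuts → Subset (n + m * p)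
  keptVertices S c = vertexSet (lookup S) (keepsVertex c)

  keptEdges : Cuts → Subset (m * k)
  keptEdges c = edgeSet (keepsEdge c)

  vertexOn∈keptVertices : ∀ {S c e t} → 0 < t → t < k → KeptVertex (lookup c e) t → vertexOn e t ∈ keptVertices S c
  vertexOn∈keptVertices {S} {c} {e} {t} 0<t t<k kept = lookup≡true⇒∈
    (trans (lookup-vertexSet-vertexOn (lookup S) (keepsVertex c) e t 0<t t<k) (dec-true (keptVertex? (lookup c e) t) kept))

  keptVertices∋vertexOn : ∀ {S c e t} → 0 < t → t < k → vertexOn e t ∈ keptVertices S c → KeptVertex (lookup c e) t
  keptVertices∋vertexOn {S} {c} {e} {t} 0<t t<k w∈ = dec-true⁻ (keptVertex? (lookup c e) t)
    (trans (sym (lookup-vertexSet-vertexOn (lookup S) (keepsVertex c) e t 0<t t<k)) (∈⇒lookup≡true w∈))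

  edgeOn∈keptEdges : ∀ {c e s q} → KeptEdge (lookup c e) s → edgeOn e s q ∈ keptEdges c
  edgeOn∈keptEdges {c} {e} {s} {q} kept = lookup≡true⇒∈
    (trans (lookup-edgeSet-edgeOn (keepsEdge c) e s q) (dec-true (keptEdge? (lookup c e) s) kept))

  keptEdges∋edgeOn : ∀ {c e s q} → edgeOn e s q ∈ keptEdges c → KeptEdge (lookup c e) s
  keptEdges∋edgeOn {c} {e} {s} {q} g∈ = dec-true⁻ (keptEdge? (lookup c e) s)
    (trans (sym (lookup-edgeSet-edgeOn (keepsEdge c) e s q)) (∈⇒lookup≡true g∈))

  orig∈keptVertices : ∀ {S c x} → x ∈ S → orig x ∈ keptVertices S c
  orig∈keptVertices {S} {c} {x} x∈ = lookup≡true⇒∈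
    (trans (lookup-vertexSet-orig (lookup S) (keepsVertex c) x) (∈⇒lookup≡true x∈))

  keptVertices∋orig : ∀ {S c x} → orig x ∈ keptVertices S c → x ∈ S
  keptVertices∋orig {S} {c} {x} w∈ = lookup≡true⇒∈
    (trans (sym (lookup-vertexSet-orig (lookup S) (keepsVertex c) x)) (∈⇒lookup≡true w∈))

  ValidCuts : Subset n → Subset m → Cuts → Set
  ValidCuts S F c = ∀ e → PathCut k (lookup F e) (lookup S (u e)) (lookup S (v e)) (lookup c e)

  CutView : Subset n → Subset m → Cuts → Fin m → Set
  CutView S F c e = (lookup F e ≡ true × cutA c e ≡ k × cutD c e ≡ k)
                  ⊎ (lookup F e ≡ false × cutA c e < cutD c e × cutD c e ≤ k ×
                     (lookup S (u e) ≡ false → cutA c e ≡ 0) × (lookup S (v e) ≡ false → cutD c e ≡ k))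

  cut-view : ∀ {S F c} → ValidCuts S F c → ∀ e → CutView S F c e
  cut-view {S} {F} {c} valid e with lookup F e | valid e
  ... | true  | cut = inj₁ (refl , cut)
  ... | false | cut = inj₂ (refl , cut)

  gap-separates : ∀ A e {a d s} (q : s < k) → a < d → d ≤ k →
    (∀ t (q′ : t < k) → A (edgeOn e t q′) → t < a ⊎ d ≤ t) → (∀ q′ → ¬ A (edgeOn e s q′)) →
    s < a ⊎ d ≤ s → ¬ Walk H A (vertexOn e s) (vertexOn e (suc s))
  gap-separates A e {a} q a<d d≤k outside-gap ¬s (inj₁ s<a) =
    separated-from-below A e _ a s<a (<-≤-trans a<d d≤k) ¬s
      (λ q′ at-a → [ <-irrefl refl , <⇒≱ a<d ]′ (outside-gap a q′ at-a))
  gap-separates A e {a} {suc l} q a<1+l _ outside-gap ¬s (inj₂ 1+l≤s) =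
    separated-from-above A e l _ 1+l≤s q
      (λ q′ at-l → [ (λ l<a → <⇒≱ l<a (≤-pred a<1+l)) , <-irrefl refl ]′ (outside-gap l q′ at-l)) ¬s

  module Extension {S : Subset n} {F : Subset m} {c : Cuts} (sub : IsSubgraph G S F) (valid : ValidCuts S F c) where
    S′ = keptVertices S c
    F′ = keptEdges c

    u∈S : ∀ {e} → 0 < cutA c e → u e ∈ S
    u∈S {e} 0<a with cut-view {S} {F} {c} valid e
    ... | inj₁ (e∈F , _) = proj₁ (sub e (lookup≡true⇒∈ e∈F))
    ... | inj₂ (_ , _ , _ , u∉⇒a≡0 , _) with true-or-false (lookup S (u e))
    ...   | inj₁ u∈  = lookup≡true⇒∈ u∈
    ...   | inj₂ u∉  = contradiction (subst (0 <_) (u∉⇒a≡0 u∉) 0<a) (<-irrefl refl)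

    v∈S : ∀ {e} → cutD c e < k ⊎ k ≤ cutA c e → v e ∈ S
    v∈S {e} d<k⊎k≤a with cut-view {S} {F} {c} valid e
    ... | inj₁ (e∈F , _) = proj₂ (sub e (lookup≡true⇒∈ e∈F))
    ... | inj₂ (_ , a<d , d≤k , _ , v∉⇒d≡k) with d<k⊎k≤a
    ...   | inj₂ k≤a = contradiction (<-≤-trans (<-≤-trans a<d d≤k) k≤a) (<-irrefl refl)
    ...   | inj₁ d<k with true-or-false (lookup S (v e))
    ...     | inj₁ v∈ = lookup≡true⇒∈ v∈
    ...     | inj₂ v∉ = contradiction (v∉⇒d≡k v∉) (<⇒≢ d<k)

    HasAll-kept : ∀ {e} → e ∈ F → HasAll (_∈ F′) e
    HasAll-kept {e} e∈F s q with cut-view {S} {F} {c} valid e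
    ... | inj₁ (_ , a≡k , _) = edgeOn∈keptEdges {c} {e} {s} {q} (inj₁ (subst (s <_) (sym a≡k) q))
    ... | inj₂ (e∉F , _)     = contradiction (trans (sym (∈⇒lookup≡true e∈F)) e∉F) λ ()

    HasAll-kept⇒∈F : ∀ {e} → HasAll (_∈ F′) e → e ∈ F
    HasAll-kept⇒∈F {e} all with cut-view {S} {F} {c} valid e
    ... | inj₁ (e∈F , _)           = lookup≡true⇒∈ e∈F
    ... | inj₂ (_ , a<d , d≤k , _)
      with keptEdges∋edgeOn {c} {e} {cutA c e} {<-≤-trans a<d d≤k} (all (cutA c e) (<-≤-trans a<d d≤k))
    ...   | inj₁ a<a = contradiction a<a (<-irrefl refl)
    ...   | inj₂ d≤a = contradiction d≤a (<⇒≱ a<d)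

    cutD-positive : ∀ e → 0 < cutD c e
    cutD-positive e with cut-view {S} {F} {c} valid e
    ... | inj₁ (_ , _ , d≡k) = subst (0 <_) (sym d≡k) (s≤s z≤n)
    ... | inj₂ (_ , a<d , _) = ≤-<-trans z≤n a<d

    lower-end-kept : ∀ {e s} → s < k → KeptEdge (lookup c e) s → vertexOn e s ∈ S′
    lower-end-kept {e} {s} q kept with start-or-interior e s q | kept
    ... | inj₂ (0<s , s<k , _) | _        = vertexOn∈keptVertices {S} {c} 0<s s<k (map₁ <⇒≤ kept)
    ... | inj₁ (refl , at-u)   | inj₁ 0<a = subst (_∈ S′) (sym at-u) (orig∈keptVertices {S} {c} (u∈S 0<a))
    ... | inj₁ (refl , _)      | inj₂ d≤0 = contradiction d≤0 (<⇒≱ (cutD-positive e))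

    upper-end-kept : ∀ {e s} → s < k → KeptEdge (lookup c e) s → vertexOn e (suc s) ∈ S′
    upper-end-kept {e} {s} q kept with interior-or-end e s q | kept
    ... | inj₁ (0<t , t<k , _) | _        = vertexOn∈keptVertices {S} {c} 0<t t<k (map₂ m≤n⇒m≤1+n kept)
    ... | inj₂ (k≤1+s , at-v)  | inj₁ s<a =
          subst (_∈ S′) (sym at-v) (orig∈keptVertices {S} {c} (v∈S (inj₂ (≤-trans k≤1+s s<a))))
    ... | inj₂ (_ , at-v)      | inj₂ d≤s =
          subst (_∈ S′) (sym at-v) (orig∈keptVertices {S} {c} (v∈S (inj₁ (≤-<-trans d≤s q))))

    extension-subgraph : IsSubgraph H S′ F′
    extension-subgraph g g∈ with edge-view g
    ... | f , s , q , refl = subst (λ (x , y) → x ∈ S′ × y ∈ S′) (sym (ends-edgeOn f s q))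
                               (lower-end-kept q kept , upper-end-kept q kept)
      where kept = keptEdges∋edgeOn {c} {f} {s} {q} g∈

    ReachesOrig : V → Set
    ReachesOrig z = Σ (Fin n) λ y → y ∈ S × Walk H (_∈ F′) z (orig y)

    interior-reaches-orig : ∀ e t → 0 < t → t < k → vertexOn e t ∈ S′ → ReachesOrig (vertexOn e t)
    interior-reaches-orig e t 0<t t<k w∈ with keptVertices∋vertexOn {S} {c} {e} {t} 0<t t<k w∈
    ... | inj₁ t≤a = u e , u∈S (<-≤-trans 0<t t≤a) , walk-reverse H (walk-along _ e 0 t z≤n (<⇒≤ t<k)
            λ s _ s<t q → edgeOn∈keptEdges {c} {e} {s} {q} (inj₁ (<-≤-trans s<t t≤a)))
    ... | inj₂ d≤t = v e , v∈S (inj₁ (≤-<-trans d≤t t<k)) , subst (Walk H _ _) vertexOn-k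
            (walk-along _ e t k (<⇒≤ t<k) ≤-refl λ s t≤s _ q → edgeOn∈keptEdges {c} {e} {s} {q} (inj₂ (≤-trans d≤t t≤s)))

    reaches-orig : ∀ {z} → z ∈ S′ → ReachesOrig z
    reaches-orig {z} z∈ with vertex-view z
    ... | inj₁ (x , refl)     = x , keptVertices∋orig {S} {c} z∈ , nil
    ... | inj₂ (e , j , refl) = subst (λ w → w ∈ S′ → ReachesOrig w) (sym (inner≡vertexOn e j))
                                      (interior-reaches-orig e (suc (toℕ j)) (s≤s z≤n) (s≤s (toℕ<n j))) z∈

    extension-connected : (∀ x y → x ∈ S → y ∈ S → Conn G F x y) →
      ∀ z z′ → z ∈ S′ → z′ ∈ S′ → Conn H F′ z z′
    extension-connected conn z z′ z∈ z′∈ =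
      let (y , y∈ , to-y) = reaches-orig z∈ ; (y′ , y′∈ , to-y′) = reaches-orig z′∈
          y-to-y′ = lift (_∈ F′) (_∈ F) (λ f f∈ → HasAll-kept f∈) (Conn⇒Walk G (conn y y′ y∈ y′∈))
      in Walk⇒Conn H (walk-++ H to-y (walk-++ H y-to-y′ (walk-reverse H to-y′)))

    -- Going around the removed path edge through the rest of its path turns the walk into one
    -- between the ends of the tree edge e; projecting it to G gives a cycle through e.
    tree-edge-acyclic : ∀ {e s} (q : s < k) → e ∈ F → ¬ Conn G (F - e) (u e) (v e) →
      ¬ Walk H (_∈ F′ - edgeOn e s q) (vertexOn e s) (vertexOn e (suc s))
    tree-edge-acyclic {e} {s} q e∈F acyc w = acyc (Walk⇒Conn G (walk-map G avoids-e (project A around)))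
      where
      A = _∈ F′ - edgeOn e s q
      other : ∀ t (q′ : t < k) → t ≢ s → A (edgeOn e t q′)
      other t q′ t≢s = x∈p∧x≢y⇒x∈p-y (HasAll-kept e∈F t q′)
                         λ eq → t≢s (proj₂ (edgeOn-injective {e} {e} {t} {s} {q′} {q} eq))
      around : Walk H A (orig (u e)) (orig (v e))
      around = walk-++ H (walk-along A e 0 s z≤n (<⇒≤ q) (λ t _ t<s q′ → other t q′ (<⇒≢ t<s)))
                 (walk-++ H w (subst (Walk H A _) vertexOn-k
                   (walk-along A e (suc s) k q ≤-refl (λ t s<t _ q′ → other t q′ (≢-sym (<⇒≢ s<t))))))
      avoids-e : ∀ f → HasAll A f → f ∈ F - e
      avoids-e f all = x∈p∧x≢y⇒x∈p-y (HasAll-kept⇒∈F (λ t q′ → x∈p-y⇒x∈p {p = F′} (all t q′)))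
                                     (λ { refl → x∈p-y⇒x≢y {p = F′} (all s q) (edgeOn-irrelevant {e} {s} {q} {q}) })

    extension-acyclic : (∀ e → e ∈ F → ¬ Conn G (F - e) (u e) (v e)) →
      ∀ g → g ∈ F′ → ¬ Conn H (F′ - g) (proj₁ (ends H g)) (proj₂ (ends H g))
    extension-acyclic acyc g g∈ conn with edge-view g
    ... | e , s , q , refl with cut-view {S} {F} {c} valid e
    ...   | inj₁ (e∈F , _) = tree-edge-acyclic q (lookup≡true⇒∈ e∈F) (acyc e (lookup≡true⇒∈ e∈F)) w
      where w = subst (λ (x , y) → Walk H _ x y) (ends-edgeOn e s q) (Conn⇒Walk H conn)
    ...   | inj₂ (_ , a<d , d≤k , _) =
            gap-separates _ e q a<d d≤k
              (λ t q′ t∈ → keptEdges∋edgeOn {c} {e} {t} {q′} (x∈p-y⇒x∈p {p = F′} t∈))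
              (λ q′ s∈ → x∈p-y⇒x≢y {p = F′} s∈ (edgeOn-irrelevant {e} {s} {q′} {q}))
              (keptEdges∋edgeOn {c} {e} {s} {q} g∈) w
      where w = subst (λ (x , y) → Walk H _ x y) (ends-edgeOn e s q) (Conn⇒Walk H conn)

    extension-subtree : IsSubtree G (S , F) → IsSubtree H (S′ , F′)
    extension-subtree (_ , (x₀ , x₀∈) , conn , acyc) =
      extension-subgraph , (orig x₀ , orig∈keptVertices {S} {c} x₀∈) , extension-connected conn , extension-acyclic acyc

  -- Subtrees inside one path

  -- (e , l , h) stands for the part of the path of e strictly between its positions l and h + 1
  Segment : Set
  Segment = Fin m × ℕ × ℕ

  ValidSegment : Segment → Set
  ValidSegment (e , l , h) = l < h × h ≤ p

  InSegment EdgeInSegment : Segment → Fin m → ℕ → Set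
  InSegment     (e , l , h) f t = f ≡ e × l < t × t ≤ h
  EdgeInSegment (e , l , h) f s = f ≡ e × l < s × suc s ≤ h

  inSegment? : ∀ y f t → Dec (InSegment y f t)
  inSegment? (e , l , h) f t = (f Fin.≟ e) ×-dec (l <? t) ×-dec (t ≤? h)

  edgeInSegment? : ∀ y f s → Dec (EdgeInSegment y f s)
  edgeInSegment? (e , l , h) f s = (f Fin.≟ e) ×-dec (l <? s) ×-dec (suc s ≤? h)

  inSegment edgeInSegment : Segment → Fin m → ℕ → Bool
  inSegment     y f t = does (inSegment? y f t)
  edgeInSegment y f s = does (edgeInSegment? y f s)

  segmentVertices : Segment → Subset (n + m * p)
  segmentVertices y = vertexSet (λ _ → false) (inSegment y)

  segmentEdges : Segment → Subset (m * k)
  segmentEdges y = edgeSet (edgeInSegment y)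

  segmentTree : Segment → Subset (n + m * p) × Subset (m * k)
  segmentTree y = segmentVertices y , segmentEdges y

  orig∉segmentVertices : ∀ y x → orig x ∉ segmentVertices y
  orig∉segmentVertices y x w∈
    with trans (sym (∈⇒lookup≡true w∈)) (lookup-vertexSet-orig (λ _ → false) (inSegment y) x)
  ... | ()

  vertexOn∈segmentVertices : ∀ {y f t} → InSegment y f t → t < k → vertexOn f t ∈ segmentVertices y
  vertexOn∈segmentVertices {y} {f} {t} in-y@(_ , l<t , _) t<k = lookup≡true⇒∈
    (trans (lookup-vertexSet-vertexOn (λ _ → false) (inSegment y) f t (≤-<-trans z≤n l<t) t<k) (dec-true (inSegment? y f t) in-y))

  segmentVertices∋vertexOn : ∀ {y f t} → 0 < t → t < k → vertexOn f t ∈ segmentVertices y → InSegment y f t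
  segmentVertices∋vertexOn {y} {f} {t} 0<t t<k w∈ = dec-true⁻ (inSegment? y f t)
    (trans (sym (lookup-vertexSet-vertexOn (λ _ → false) (inSegment y) f t 0<t t<k)) (∈⇒lookup≡true w∈))

  edgeOn∈segmentEdges : ∀ {y f s q} → EdgeInSegment y f s → edgeOn f s q ∈ segmentEdges y
  edgeOn∈segmentEdges {y} {f} {s} {q} in-y = lookup≡true⇒∈
    (trans (lookup-edgeSet-edgeOn (edgeInSegment y) f s q) (dec-true (edgeInSegment? y f s) in-y))

  segmentEdges∋edgeOn : ∀ {y f s q} → edgeOn f s q ∈ segmentEdges y → EdgeInSegment y f s
  segmentEdges∋edgeOn {y} {f} {s} {q} g∈ =
    dec-true⁻ (edgeInSegment? y f s) (trans (sym (lookup-edgeSet-edgeOn (edgeInSegment y) f s q)) (∈⇒lookup≡true g∈))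

  segmentVertices-view : ∀ {e l h z} → z ∈ segmentVertices (e , l , h) →
    Σ ℕ λ t → l < t × t ≤ h × z ≡ vertexOn e t
  segmentVertices-view {e} {l} {h} {z} z∈ with vertex-view z
  ... | inj₁ (x , refl) = contradiction z∈ (orig∉segmentVertices (e , l , h) x)
  ... | inj₂ (f , j , refl) with segmentVertices∋vertexOn {e , l , h} {f} {suc (toℕ j)} (s≤s z≤n) (s≤s (toℕ<n j))
                                  (subst (_∈ segmentVertices (e , l , h)) (inner≡vertexOn f j) z∈)
  ...   | refl , l<t , t≤h = suc (toℕ j) , l<t , t≤h , inner≡vertexOn e j

  segmentTree-subtree : ∀ y → ValidSegment y → IsSubtree H (segmentTree y)
  segmentTree-subtree (e , l , h) (l<h , h≤p) =
    subgraph , (vertexOn e h , vertexOn∈segmentVertices (refl , l<h , ≤-refl) h<k) , connected , acyclic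
    where
    y = e , l , h
    h<k : h < k
    h<k = s≤s h≤p
    subgraph : IsSubgraph H (segmentVertices y) (segmentEdges y)
    subgraph g g∈ with edge-view g
    ... | f , s , q , refl with segmentEdges∋edgeOn {y} {f} {s} {q} g∈
    ...   | refl , l<s , 1+s≤h = subst (λ (x , z) → x ∈ segmentVertices y × z ∈ segmentVertices y) (sym (ends-edgeOn f s q))
              (vertexOn∈segmentVertices (refl , l<s , <⇒≤ 1+s≤h) q ,
               vertexOn∈segmentVertices (refl , m<n⇒m<1+n l<s , 1+s≤h) (≤-<-trans 1+s≤h h<k))
    to-top : ∀ {z} → z ∈ segmentVertices y → Walk H (_∈ segmentEdges y) z (vertexOn e h)
    to-top z∈ with segmentVertices-view z∈
    ... | t , l<t , t≤h , refl =
      walk-along _ e t h t≤h (<⇒≤ h<k) λ s t≤s s<h q →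
        edgeOn∈segmentEdges {y} {e} {s} {q} (refl , <-≤-trans l<t t≤s , s<h)
    connected : ∀ x z → x ∈ segmentVertices y → z ∈ segmentVertices y → Conn H (segmentEdges y) x z
    connected x z x∈ z∈ = Walk⇒Conn H (walk-++ H (to-top x∈) (walk-reverse H (to-top z∈)))
    acyclic : ∀ g → g ∈ segmentEdges y → ¬ Conn H (segmentEdges y - g) (proj₁ (ends H g)) (proj₂ (ends H g))
    acyclic g g∈ conn with edge-view g
    ... | f , s , q , refl with segmentEdges∋edgeOn {y} {f} {s} {q} g∈
    ...   | refl , l<s , _ = separated-from-above _ e l s l<s q
            (λ q′ l∈ → <-irrefl refl
               (proj₁ (proj₂ (segmentEdges∋edgeOn {y} {e} {l} {q′} (x∈p-y⇒x∈p {p = segmentEdges y} l∈)))))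
            (λ q′ s∈ → x∈p-y⇒x≢y {p = segmentEdges y} s∈ (edgeOn-irrelevant {e} {s} {q′} {q}))
            (subst (λ (x , z) → Walk H _ x z) (ends-edgeOn e s q) (Conn⇒Walk H conn))

  -- The path and the last position h of a segment are read off at vertexOn e h, and l at vertexOn e (l + 1).
  segmentTree-injective : ∀ y y′ → ValidSegment y → ValidSegment y′ → segmentTree y ≡ segmentTree y′ → y ≡ y′
  segmentTree-injective (e , l , h) (e′ , l′ , h′) (l<h , h≤p) (l′<h′ , h′≤p) eq =
    cong₂ _,_ e≡e′ (cong₂ _,_ (≤-antisym (≤-pred l<1+l′) (≤-pred l′<1+l)) (≤-antisym h≤h′ h′≤h))
    where
    to′ : ∀ {z} → z ∈ segmentVertices (e , l , h) → z ∈ segmentVertices (e′ , l′ , h′)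
    to′ = subst (λ S → _ ∈ S) (cong proj₁ eq)
    from′ : ∀ {z} → z ∈ segmentVertices (e′ , l′ , h′) → z ∈ segmentVertices (e , l , h)
    from′ = subst (λ S → _ ∈ S) (sym (cong proj₁ eq))
    h<k = s≤s h≤p
    h′<k = s≤s h′≤p
    top = segmentVertices∋vertexOn {e′ , l′ , h′} (≤-<-trans z≤n l<h) h<k
            (to′ (vertexOn∈segmentVertices (refl , l<h , ≤-refl) h<k))
    top′ = segmentVertices∋vertexOn {e , l , h} (≤-<-trans z≤n l′<h′) h′<k
             (from′ (vertexOn∈segmentVertices (refl , l′<h′ , ≤-refl) h′<k))
    bottom = segmentVertices∋vertexOn {e′ , l′ , h′} (s≤s z≤n) (≤-<-trans l<h h<k)
               (to′ (vertexOn∈segmentVertices (refl , ≤-refl , l<h) (≤-<-trans l<h h<k)))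
    bottom′ = segmentVertices∋vertexOn {e , l , h} (s≤s z≤n) (≤-<-trans l′<h′ h′<k)
                (from′ (vertexOn∈segmentVertices (refl , ≤-refl , l′<h′) (≤-<-trans l′<h′ h′<k)))
    e≡e′ = proj₁ top
    h≤h′ = proj₂ (proj₂ top)
    h′≤h = proj₂ (proj₂ top′)
    l′<1+l = proj₁ (proj₂ bottom)
    l<1+l′ = proj₁ (proj₂ bottom′)

  -- Every subtree of the stretch arises exactly once

  Decorated : Set
  Decorated = (Subset n × Subset m) × Cuts

  ValidDecorated : Decorated → Set
  ValidDecorated ((S , F) , c) = IsSubtree G (S , F) × ValidCuts S F c

  extensionTree : Decorated → Subset (n + m * p) × Subset (m * k)
  extensionTree ((S , F) , c) = keptVertices S c , keptEdges c

  -- S is read off at the original vertices, F as the edges whose whole path is kept, and each cut from its gap.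
  extensionTree-injective : ∀ x x′ → ValidDecorated x → ValidDecorated x′ →
    extensionTree x ≡ extensionTree x′ → x ≡ x′
  extensionTree-injective ((S₁ , F₁) , c₁) ((S₂ , F₂) , c₂) ((sub₁ , _) , valid₁) ((sub₂ , _) , valid₂) eq =
    cong₂ _,_ (cong₂ _,_ S₁≡S₂ F₁≡F₂) (Vec-ext c₁ c₂ same-cut)
    where
    module E₁ = Extension {S₁} {F₁} {c₁} sub₁ valid₁
    module E₂ = Extension {S₂} {F₂} {c₂} sub₂ valid₂
    S′₁⊆S′₂ : keptVertices S₁ c₁ ⊆ keptVertices S₂ c₂
    S′₁⊆S′₂ = subst (λ S → _ ∈ S) (cong proj₁ eq)
    S′₂⊆S′₁ : keptVertices S₂ c₂ ⊆ keptVertices S₁ c₁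
    S′₂⊆S′₁ = subst (λ S → _ ∈ S) (cong proj₁ (sym eq))
    F′₁⊆F′₂ : keptEdges c₁ ⊆ keptEdges c₂
    F′₁⊆F′₂ = subst (λ F → _ ∈ F) (cong proj₂ eq)
    F′₂⊆F′₁ : keptEdges c₂ ⊆ keptEdges c₁
    F′₂⊆F′₁ = subst (λ F → _ ∈ F) (cong proj₂ (sym eq))
    S₁≡S₂ : S₁ ≡ S₂
    S₁≡S₂ = ⊆-antisym (λ x∈ → keptVertices∋orig {S₂} {c₂} (S′₁⊆S′₂ (orig∈keptVertices {S₁} {c₁} x∈)))
                      (λ x∈ → keptVertices∋orig {S₁} {c₁} (S′₂⊆S′₁ (orig∈keptVertices {S₂} {c₂} x∈)))
    F₁≡F₂ : F₁ ≡ F₂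
    F₁≡F₂ = ⊆-antisym (λ e∈ → E₂.HasAll-kept⇒∈F (λ s q → F′₁⊆F′₂ (E₁.HasAll-kept e∈ s q)))
                      (λ e∈ → E₁.HasAll-kept⇒∈F (λ s q → F′₂⊆F′₁ (E₂.HasAll-kept e∈ s q)))
    same-cut : ∀ e → lookup c₁ e ≡ lookup c₂ e
    same-cut e with cut-view {S₁} {F₁} {c₁} valid₁ e | cut-view {S₂} {F₂} {c₂} valid₂ e
    ... | inj₁ (_ , a₁≡k , d₁≡k) | inj₁ (_ , a₂≡k , d₂≡k) =
          cong₂ _,_ (trans a₁≡k (sym a₂≡k)) (trans d₁≡k (sym d₂≡k))
    ... | inj₁ (e∈F₁ , _) | inj₂ (e∉F₂ , _) =
          contradiction (trans (sym e∈F₁) (trans (cong (λ F → lookup F e) F₁≡F₂) e∉F₂)) λ ()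
    ... | inj₂ (e∉F₁ , _) | inj₁ (e∈F₂ , _) =
          contradiction (trans (sym e∈F₂) (trans (cong (λ F → lookup F e) (sym F₁≡F₂)) e∉F₁)) λ ()
    ... | inj₂ (_ , a₁<d₁ , d₁≤k , _) | inj₂ (_ , a₂<d₂ , d₂≤k , _) = cut-unique a₁<d₁ d₁≤k a₂<d₂ d₂≤k
          (λ s q kept → keptEdges∋edgeOn {c₂} {e} {s} {q} (F′₁⊆F′₂ (edgeOn∈keptEdges {c₁} {e} {s} {q} kept)))
          (λ s q kept → keptEdges∋edgeOn {c₁} {e} {s} {q} (F′₂⊆F′₁ (edgeOn∈keptEdges {c₂} {e} {s} {q} kept)))

  module InTree {S′ : Subset (n + m * p)} {F′ : Subset (m * k)} (tree : IsSubtree H (S′ , F′)) where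
    A : Fin (m * k) → Set
    A = _∈ F′

    connected : ∀ x y → x ∈ S′ → y ∈ S′ → Conn H F′ x y
    connected = proj₁ (proj₂ (proj₂ tree))

    Has? : ∀ e s → Dec (Has A e s)
    Has? e s with s <? k
    ... | no s≮k = yes λ s<k → contradiction s<k s≮k
    ... | yes s<k with edgeOn e s s<k ∈? F′
    ...   | yes s∈ = yes (has A s<k s∈)
    ...   | no s∉  = no λ present → s∉ (present s<k)

    edge-ends : ∀ {e s} → s < k → Has A e s → vertexOn e s ∈ S′ × vertexOn e (suc s) ∈ S′
    edge-ends {e} {s} q present = subst (λ (x , y) → x ∈ S′ × y ∈ S′) (ends-edgeOn e s q) (proj₁ tree _ (present q))

    ¬Has⇒∉ : ∀ {e s} → ¬ Has A e s → ∀ (q : s < k) → ¬ A (edgeOn e s q)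
    ¬Has⇒∉ ¬present q s∈ = ¬present (has A q s∈)

    trapped : ∀ {e l h t z} → h < k → ¬ Has A e l → ¬ Has A e h → l < t → t ≤ h →
      vertexOn e t ∈ S′ → z ∈ S′ → Between e l h z
    trapped {e} {l} {h} {t} h<k ¬l ¬h l<t t≤h w∈ z∈ =
      walk-invariant H (Between e l h) (Between-invariant A e l h h<k (¬Has⇒∉ ¬l) (¬Has⇒∉ ¬h))
        (Conn⇒Walk H (connected _ _ w∈ z∈)) (t , l<t , t≤h , refl)

    orig∉Between : ∀ {e l h x} → h < k → ¬ Between e l h (orig x)
    orig∉Between {e} h<k (t , l<t , t≤h , at) =
      Interior⇒≢orig {vertexOn e t} {e} {t} (≤-<-trans z≤n l<t , ≤-<-trans t≤h h<k , refl) (sym at)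

    HasBelow⊎HasFrom : ∀ {x₀} → orig x₀ ∈ S′ → ∀ e t → t < k → vertexOn e t ∈ S′ →
      HasBelow A e t ⊎ HasFrom A e t
    HasBelow⊎HasFrom x₀∈ e t t<k w∈ with first-failure (Has A e) (Has? e) 0 t
    ... | inj₁ below = inj₁ λ s → below s z≤n
    ... | inj₂ (s₀ , _ , s₀<t , ¬s₀ , _) with first-failure (Has A e) (Has? e) t k
    ...   | inj₁ from = inj₂ λ s t≤s q → from s t≤s q q
    ...   | inj₂ (h , t≤h , h<k , ¬h , _) with last-failure (Has A e) (Has? e) t (s₀ , s₀<t , ¬s₀)
    ...     | L , L<t , ¬L , _ =
              contradiction (trapped {e} {L} {h} {t} h<k ¬L ¬h L<t t≤h w∈ x₀∈) (orig∉Between {e} h<k)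

  module Restriction {S′ : Subset (n + m * p)} {F′ : Subset (m * k)} (tree : IsSubtree H (S′ , F′)) {x₀ : Fin n}
                     (x₀∈ : orig x₀ ∈ S′) where
    open InTree tree

    MissingRange : Fin m → ℕ → ℕ → Set
    MissingRange e a L = a ≤ L × L < k × ¬ Has A e a × ¬ Has A e L × HasBelow A e a × HasFrom A e (suc L)

    PathShape : Fin m → Set
    PathShape e = HasAll A e ⊎ Σ ℕ λ a → Σ ℕ λ L → MissingRange e a L

    path-shape : ∀ e → PathShape e
    path-shape e with first-failure (Has A e) (Has? e) 0 k
    ... | inj₁ all = inj₁ λ s q → all s z≤n q q
    ... | inj₂ (a , _ , a<k , ¬a , below) with last-failure (Has A e) (Has? e) k (a , a<k , ¬a)
    ...   | L , L<k , ¬L , above =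
            inj₂ (a , L , ≮⇒≥ (λ L<a → ¬L (below L z≤n L<a)) , L<k , ¬a , ¬L ,
                  (λ s → below s z≤n) , λ s L<s q → above s L<s q q)

    keepsWholePath : ∀ {e} → PathShape e → Bool
    keepsWholePath (inj₁ _) = true
    keepsWholePath (inj₂ _) = false

    cutOf : ∀ {e} → PathShape e → ℕ × ℕ
    cutOf (inj₁ _)           = k , k
    cutOf (inj₂ (a , L , _)) = a , suc L

    S₀ : Subset n
    S₀ = tabulate (λ x → lookup S′ (orig x))

    F₀ : Subset m
    F₀ = tabulate (keepsWholePath ∘ path-shape)

    c₀ : Cuts
    c₀ = tabulate (cutOf ∘ path-shape)

    S₀-orig : ∀ {x} → x ∈ S₀ → orig x ∈ S′
    S₀-orig x∈ = lookup≡true⇒∈ (∈-tabulate⁻ x∈)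

    orig-S₀ : ∀ {x} → orig x ∈ S′ → x ∈ S₀
    orig-S₀ w∈ = ∈-tabulate⁺ (∈⇒lookup≡true w∈)

    u∈S₀ : ∀ e → Has A e 0 → u e ∈ S₀
    u∈S₀ e present = orig-S₀ (proj₁ (edge-ends (s≤s z≤n) present))

    v∈S₀ : ∀ e → Has A e p → v e ∈ S₀
    v∈S₀ e present = orig-S₀ (subst (_∈ S′) vertexOn-k (proj₂ (edge-ends ≤-refl present)))

    HasAll⇒∈F₀ : ∀ {e} → HasAll A e → e ∈ F₀
    HasAll⇒∈F₀ {e} all with path-shape e in shape
    ... | inj₁ _                            = ∈-tabulate⁺ (cong keepsWholePath shape)
    ... | inj₂ (a , _ , _ , _ , ¬a , _)     = contradiction (all a) ¬a

    ∈F₀⇒HasAll : ∀ {e} → e ∈ F₀ → HasAll A e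
    ∈F₀⇒HasAll {e} e∈ with path-shape e | ∈-tabulate⁻ {f = keepsWholePath ∘ path-shape} e∈
    ... | inj₁ all | _ = all

    lookup-c₀ : ∀ e → lookup c₀ e ≡ cutOf (path-shape e)
    lookup-c₀ = lookup∘tabulate (cutOf ∘ path-shape)

    gap-empty : ∀ {e a L t} → MissingRange e a L → a < t → t ≤ L → vertexOn e t ∉ S′
    gap-empty {e} {a} {L} {t} (_ , L<k , ¬a , ¬L , _) a<t t≤L w∈
      with HasBelow⊎HasFrom x₀∈ e t (≤-<-trans t≤L L<k) w∈
    ... | inj₁ below = ¬a (below a a<t)
    ... | inj₂ from  = ¬L (from L t≤L)

    kept⇒Has : ∀ {e} (shape : PathShape e) s → KeptEdge (cutOf shape) s → Has A e s
    kept⇒Has (inj₁ all) s _ = all s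
    kept⇒Has (inj₂ (_ , _ , _ , _ , _ , _ , below , _)) s (inj₁ s<a) = below s s<a
    kept⇒Has (inj₂ (_ , _ , _ , _ , _ , _ , _ , from)) s (inj₂ L<s) = from s L<s

    Has⇒kept : ∀ {e} (shape : PathShape e) s (q : s < k) → Has A e s → KeptEdge (cutOf shape) s
    Has⇒kept (inj₁ _) s q _ = inj₁ q
    Has⇒kept (inj₂ (a , L , range)) s q present with s <? a | L <? s
    ... | yes s<a | _       = inj₁ s<a
    ... | no _    | yes L<s = inj₂ L<s
    ... | no s≮a  | no L≮s with m≤n⇒m<n∨m≡n (≮⇒≥ s≮a)
    ...   | inj₂ refl = contradiction present (proj₁ (proj₂ (proj₂ range)))
    ...   | inj₁ a<s  = contradiction (proj₁ (edge-ends q present)) (gap-empty range a<s (≮⇒≥ L≮s))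

    kept⇒∈ : ∀ {e} (shape : PathShape e) t → 0 < t → t < k → KeptVertex (cutOf shape) t → vertexOn e t ∈ S′
    kept⇒∈ (inj₁ all) t _ t<k _ = proj₁ (edge-ends t<k (all t))
    kept⇒∈ (inj₂ (_ , _ , _ , _ , _ , _ , below , _)) (suc t) _ 1+t<k (inj₁ 1+t≤a) =
      proj₂ (edge-ends (<⇒≤ 1+t<k) (below t 1+t≤a))
    kept⇒∈ (inj₂ (_ , _ , _ , _ , _ , _ , _ , from)) t _ t<k (inj₂ L<t) = proj₁ (edge-ends t<k (from t L<t))

    ∈⇒kept : ∀ {e} (shape : PathShape e) t → t < k → vertexOn e t ∈ S′ → KeptVertex (cutOf shape) t
    ∈⇒kept (inj₁ _) t t<k _ = inj₁ (<⇒≤ t<k)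
    ∈⇒kept (inj₂ (a , L , range)) t t<k w∈ with t ≤? a | L <? t
    ... | yes t≤a | _       = inj₁ t≤a
    ... | no _    | yes L<t = inj₂ L<t
    ... | no t≰a  | no L≮t  = contradiction w∈ (gap-empty range (≰⇒> t≰a) (≮⇒≥ L≮t))

    restriction-subtree : IsSubtree G (S₀ , F₀)
    restriction-subtree = subgraph , (x₀ , orig-S₀ x₀∈) , connected₀ , acyclic₀
      where
      subgraph : IsSubgraph G S₀ F₀
      subgraph e e∈ = u∈S₀ e (∈F₀⇒HasAll e∈ 0) , v∈S₀ e (∈F₀⇒HasAll e∈ p)
      connected₀ : ∀ x y → x ∈ S₀ → y ∈ S₀ → Conn G F₀ x y
      connected₀ x y x∈ y∈ =
        Walk⇒Conn G (walk-map G (λ _ → HasAll⇒∈F₀)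
          (project A (Conn⇒Walk H (connected (orig x) (orig y) (S₀-orig x∈) (S₀-orig y∈)))))
      -- A cycle of (S₀ , F₀) through e lifts to a cycle of the tree through the first edge of the path of e.
      acyclic₀ : ∀ e → e ∈ F₀ → ¬ Conn G (F₀ - e) (u e) (v e)
      acyclic₀ e e∈ conn = proj₂ (proj₂ (proj₂ tree)) (edgeOn e 0 0<k) (all 0 0<k)
        (Walk⇒Conn H (subst (λ (x , y) → Walk H A₀ x y) (sym (ends-edgeOn e 0 0<k))
                              (walk-++ H around (walk-reverse H back))))
        where
        0<k = s≤s z≤n
        all = ∈F₀⇒HasAll e∈
        A₀ = _∈ F′ - edgeOn e 0 0<k
        around : Walk H A₀ (orig (u e)) (orig (v e))
        around = lift A₀ (_∈ F₀ - e)
          (λ f f∈ s q → x∈p∧x≢y⇒x∈p-y (∈F₀⇒HasAll (x∈p-y⇒x∈p {p = F₀} f∈) s q)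
                          λ eq → x∈p-y⇒x≢y {p = F₀} f∈ (proj₁ (edgeOn-injective {f} {e} {s} {0} {q} {0<k} eq)))
          (Conn⇒Walk G conn)
        back : Walk H A₀ (vertexOn e 1) (orig (v e))
        back = subst (Walk H A₀ _) vertexOn-k (walk-along A₀ e 1 k (s≤s z≤n) ≤-refl λ s 1≤s _ q →
          x∈p∧x≢y⇒x∈p-y (all s q)
            λ eq → <-irrefl (sym (proj₂ (edgeOn-injective {e} {e} {s} {0} {q} {0<k} eq))) 1≤s)

    restriction-valid : ValidCuts S₀ F₀ c₀
    restriction-valid e rewrite lookup∘tabulate (keepsWholePath ∘ path-shape) e | lookup-c₀ e with path-shape e
    ... | inj₁ _ = refl , refl
    ... | inj₂ (a , L , a≤L , L<k , _ , _ , below , from) = s≤s a≤L , L<k , a≡0 , 1+L≡k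
      where
      a≡0 : lookup S₀ (u e) ≡ false → a ≡ 0
      a≡0 u∉ = n≤0⇒n≡0 (≮⇒≥ λ 0<a →
        contradiction (trans (sym (∈⇒lookup≡true (u∈S₀ e (below 0 0<a)))) u∉) λ ())
      1+L≡k : lookup S₀ (v e) ≡ false → suc L ≡ k
      1+L≡k v∉ with suc L <? k
      ... | yes 1+L<k = contradiction (trans (sym (∈⇒lookup≡true (v∈S₀ e (from p (≤-pred 1+L<k))))) v∉) λ ()
      ... | no 1+L≮k  = ≤-antisym L<k (≮⇒≥ 1+L≮k)

    restriction-vertices : keptVertices S₀ c₀ ≡ S′
    restriction-vertices = ⊆-antisym kept⊆ ⊆kept
      where
      kept⊆ : keptVertices S₀ c₀ ⊆ S′
      kept⊆ {w} w∈ with vertex-view w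
      ... | inj₁ (x , refl) = S₀-orig (keptVertices∋orig {S₀} {c₀} w∈)
      ... | inj₂ (e , j , refl) rewrite inner≡vertexOn e j =
            kept⇒∈ (path-shape e) (suc (toℕ j)) (s≤s z≤n) (s≤s (toℕ<n j))
              (subst (λ ad → KeptVertex ad (suc (toℕ j))) (lookup-c₀ e)
                     (keptVertices∋vertexOn {S₀} {c₀} (s≤s z≤n) (s≤s (toℕ<n j)) w∈))
      ⊆kept : S′ ⊆ keptVertices S₀ c₀
      ⊆kept {w} w∈ with vertex-view w
      ... | inj₁ (x , refl) = orig∈keptVertices {S₀} {c₀} (orig-S₀ w∈)
      ... | inj₂ (e , j , refl) rewrite inner≡vertexOn e j =
            vertexOn∈keptVertices {S₀} {c₀} (s≤s z≤n) (s≤s (toℕ<n j))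
              (subst (λ ad → KeptVertex ad (suc (toℕ j))) (sym (lookup-c₀ e))
                     (∈⇒kept (path-shape e) (suc (toℕ j)) (s≤s (toℕ<n j)) w∈))

    restriction-edges : keptEdges c₀ ≡ F′
    restriction-edges = ⊆-antisym kept⊆ ⊆kept
      where
      kept⊆ : keptEdges c₀ ⊆ F′
      kept⊆ {g} g∈ with edge-view g
      ... | e , s , q , refl =
            kept⇒Has (path-shape e) s (subst (λ ad → KeptEdge ad s) (lookup-c₀ e) (keptEdges∋edgeOn {c₀} {e} {s} {q} g∈)) q
      ⊆kept : F′ ⊆ keptEdges c₀
      ⊆kept {g} g∈ with edge-view g
      ... | e , s , q , refl =
            edgeOn∈keptEdges {c₀} {e} {s} {q}
              (subst (λ ad → KeptEdge ad s) (sym (lookup-c₀ e)) (Has⇒kept (path-shape e) s q (has A q g∈)))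

    extensionTree-onto : Σ Decorated λ x → ValidDecorated x × extensionTree x ≡ (S′ , F′)
    extensionTree-onto = ((S₀ , F₀) , c₀) , (restriction-subtree , restriction-valid) ,
                         cong₂ _,_ restriction-vertices restriction-edges

  module InnerTree {S′ : Subset (n + m * p)} {F′ : Subset (m * k)} (tree : IsSubtree H (S′ , F′))
                   (no-orig : ∀ x → orig x ∉ S′) where
    open InTree tree

    segment-from-gaps : ∀ e {l t h} → l < t → t ≤ h → h < k → vertexOn e t ∈ S′ → ¬ Has A e l → ¬ Has A e h →
      (∀ s → l < s → s < h → Has A e s) → segmentTree (e , l , h) ≡ (S′ , F′)
    segment-from-gaps e {l} {t} {h} l<t t≤h h<k w∈ ¬l ¬h between =
      cong₂ _,_ (⊆-antisym segment⊆ ⊆segment) (⊆-antisym edges⊆ ⊆edges)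
      where
      y = e , l , h
      in-segment : ∀ {z} → z ∈ S′ → Σ ℕ λ t′ → InSegment y e t′ × z ≡ vertexOn e t′
      in-segment z∈ with trapped {e} {l} {h} {t} h<k ¬l ¬h l<t t≤h w∈ z∈
      ... | t′ , l<t′ , t′≤h , at = t′ , (refl , l<t′ , t′≤h) , at
      segment⊆ : segmentVertices y ⊆ S′
      segment⊆ z∈ with segmentVertices-view z∈
      ... | t′ , l<t′ , t′≤h , refl with <-cmp t′ t
      ...   | tri< t′<t _ _ =
              proj₁ (edge-ends (<-≤-trans t′<t (≤-trans t≤h (<⇒≤ h<k))) (between t′ l<t′ (<-≤-trans t′<t t≤h)))
      ...   | tri≈ _ refl _ = w∈
      ...   | tri> _ _ t<t′ with t′ | t<t′
      ...     | suc s | 1+t≤1+s = proj₂ (edge-ends (<-≤-trans (n<1+n s) (≤-trans t′≤h (<⇒≤ h<k)))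
                                                    (between s (<-≤-trans l<t (≤-pred 1+t≤1+s)) t′≤h))
      ⊆segment : S′ ⊆ segmentVertices y
      ⊆segment z∈ with in-segment z∈
      ... | t′ , in-y , refl = vertexOn∈segmentVertices in-y (≤-<-trans (proj₂ (proj₂ in-y)) h<k)
      edges⊆ : segmentEdges y ⊆ F′
      edges⊆ {g} g∈ with edge-view g
      ... | f , s , q , refl with segmentEdges∋edgeOn {y} {f} {s} {q} g∈
      ...   | refl , l<s , s<h = between s l<s s<h q
      ⊆edges : F′ ⊆ segmentEdges y
      ⊆edges {g} g∈ with edge-view g
      ... | f , s , q , refl
          with in-segment (proj₁ (edge-ends q (has A q g∈))) | in-segment (proj₂ (edge-ends q (has A q g∈)))
      ...   | t₁ , (_ , l<t₁ , t₁≤h) , at₁ | t₂ , (_ , l<t₂ , t₂≤h) , at₂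
            with vertexOn-injective {f} {s} {e} {t₁} (≤-<-trans z≤n l<t₁) (≤-<-trans t₁≤h h<k) at₁
               | vertexOn-injective {f} {suc s} {e} {t₂} (≤-<-trans z≤n l<t₂) (≤-<-trans t₂≤h h<k) at₂
      ...     | refl , refl | _ , refl = edgeOn∈segmentEdges {y} {e} {s} {q} (refl , l<t₁ , t₂≤h)

    first-edge-missing : ∀ e → ¬ Has A e 0
    first-edge-missing e present = no-orig (u e) (proj₁ (edge-ends (s≤s z≤n) present))

    last-edge-missing : ∀ e → ¬ Has A e p
    last-edge-missing e present = no-orig (v e) (subst (_∈ S′) vertexOn-k (proj₂ (edge-ends ≤-refl present)))

    segment-through : ∀ e t → 0 < t → t < k → vertexOn e t ∈ S′ →
      Σ Segment λ y → ValidSegment y × segmentTree y ≡ (S′ , F′)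
    segment-through e t 0<t t<k w∈
      with last-failure (Has A e) (Has? e) t (0 , 0<t , first-edge-missing e) | first-failure (Has A e) (Has? e) t k
    ... | _ | inj₁ from = contradiction (from p (≤-pred t<k) ≤-refl) (last-edge-missing e)
    ... | L , L<t , ¬L , above | inj₂ (h , t≤h , h<k , ¬h , below) =
          (e , L , h) , (<-≤-trans L<t t≤h , ≤-pred h<k) , segment-from-gaps e L<t t≤h h<k w∈ ¬L ¬h between
      where
      between : ∀ s → L < s → s < h → Has A e s
      between s L<s s<h with s <? t
      ... | yes s<t = above s L<s s<t
      ... | no s≮t  = below s (≮⇒≥ s≮t) s<h

    segmentTree-onto : Σ Segment λ y → ValidSegment y × segmentTree y ≡ (S′ , F′)
    segmentTree-onto with proj₁ (proj₂ tree)
    ... | z , z∈ with vertex-view z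
    ...   | inj₁ (x , refl)     = contradiction z∈ (no-orig x)
    ...   | inj₂ (e , j , refl) =
            segment-through e (suc (toℕ j)) (s≤s z≤n) (s≤s (toℕ<n j)) (subst (_∈ S′) (inner≡vertexOn e j) z∈)

  count-cuts : ∀ {i j S F} → IsSubtree[_,_] G i j (S , F) → Count (ValidCuts S F) (k ^ i * (suc k C 2) ^ j)
  count-cuts {S = S} {F} (_ , refl , refl) =
    subst (Count _) (∏-cutCount k (suc k C 2) (lookup F) (lookup S ∘ u) (lookup S ∘ v))
      (count-Vec (λ e → PathCut k (lookup F e) (lookup S (u e)) (lookup S (v e)))
                 (λ e → cutCount k (suc k C 2) (lookup F e) (lookup S (u e)) (lookup S (v e)))
                 (λ e → count-PathCut k (s≤s z≤n) (lookup F e) (lookup S (u e)) (lookup S (v e))))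

  count-decorated : (t : ℕ → ℕ → ℕ) → (∀ i j → Count (IsSubtree[_,_] G i j) (t i j)) →
    Count ValidDecorated (Σ< (suc m) (λ i → Σ< (suc m) (λ j → t i j * k ^ i * (suc k C 2) ^ j)))
  count-decorated t count-t =
    subst (Count _) (Σ<-cong (suc m) λ i → Σ<-cong (suc m) λ j → sym (*-assoc (t i j) (k ^ i) ((suc k C 2) ^ j)))
      (count-⇔ (count-⋃< Graded weight count-Graded grade-unique (suc m))
               (λ _ (_ , _ , _ , _ , (T , _) , cuts) → T , cuts) graded)
    where
    Decorated[_,_] : ℕ → ℕ → Decorated → Set
    Decorated[ i , j ] x = IsSubtree[_,_] G i j (proj₁ x) × ValidCuts (proj₁ (proj₁ x)) (proj₂ (proj₁ x)) (proj₂ x)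
    Graded : ℕ → Decorated → Set
    Graded i x = Σ ℕ λ j → j < suc m × Decorated[ i , j ] x
    weight : ℕ → ℕ
    weight i = Σ< (suc m) λ j → t i j * (k ^ i * (suc k C 2) ^ j)
    count-Graded : ∀ i → Count (Graded i) (weight i)
    count-Graded i = count-⋃< Decorated[ i ,_] _ (λ j → count-Σ (count-t i j) (λ _ → count-cuts))
                       (λ _ _ _ ((_ , _ , j≡) , _) ((_ , _ , j′≡) , _) → trans (sym j≡) j′≡) (suc m)
    grade-unique : ∀ i i′ x → Graded i x → Graded i′ x → i ≡ i′
    grade-unique _ _ _ (_ , _ , (_ , i≡ , _) , _) (_ , _ , (_ , i′≡ , _) , _) = trans (sym i≡) i′≡
    graded : ∀ x → ValidDecorated x → Σ ℕ λ i → i < suc m × Graded i x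
    graded ((S , F) , c) (T , cuts) =
      extOne G (S , F) , s≤s (∣p∣≤n (tabulate λ e → not (lookup F e) ∧ (lookup S (u e) xor lookup S (v e)))) ,
      extBoth G (S , F) , s≤s (∣p∣≤n (tabulate λ e → not (lookup F e) ∧ (lookup S (u e) ∧ lookup S (v e)))) ,
      (T , refl , refl) , cuts

  count-segments : Count ValidSegment (m * (suc p C 2))
  count-segments =
    count-⇔ (count-Σ {Q = λ _ lh → proj₁ lh < proj₂ lh × proj₂ lh ≤ p} (count-Fin m) (λ _ _ → count-gaps p))
            (λ _ → proj₂) (λ _ valid → tt , valid)

  treeOf : Decorated ⊎ Segment → Subset (n + m * p) × Subset (m * k)
  treeOf = [ extensionTree , segmentTree ]′

  ValidSource : Decorated ⊎ Segment → Set
  ValidSource = [ ValidDecorated , ValidSegment ]′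

  treeOf-subtree : ∀ x → ValidSource x → IsSubtree H (treeOf x)
  treeOf-subtree (inj₁ ((S , F) , c)) (T , cuts) = Extension.extension-subtree {S} {F} {c} (proj₁ T) cuts T
  treeOf-subtree (inj₂ y)             valid      = segmentTree-subtree y valid

  extensionTree≢segmentTree : ∀ x y → ValidDecorated x → extensionTree x ≢ segmentTree y
  extensionTree≢segmentTree ((S , F) , c) y ((_ , (x₀ , x₀∈) , _) , _) eq =
    orig∉segmentVertices y x₀ (subst (λ T → orig x₀ ∈ proj₁ T) eq (orig∈keptVertices {S} {c} x₀∈))

  treeOf-injective : ∀ x x′ → ValidSource x → ValidSource x′ → treeOf x ≡ treeOf x′ → x ≡ x′
  treeOf-injective (inj₁ x) (inj₁ x′) valid valid′ eq = cong inj₁ (extensionTree-injective x x′ valid valid′ eq)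
  treeOf-injective (inj₂ y) (inj₂ y′) valid valid′ eq = cong inj₂ (segmentTree-injective y y′ valid valid′ eq)
  treeOf-injective (inj₁ x) (inj₂ y)  valid _      eq = contradiction eq (extensionTree≢segmentTree x y valid)
  treeOf-injective (inj₂ y) (inj₁ x)  _     valid′ eq = contradiction (sym eq) (extensionTree≢segmentTree x y valid′)

  treeOf-onto : ∀ T → IsSubtree H T → Σ (Decorated ⊎ Segment) λ x → ValidSource x × treeOf x ≡ T
  treeOf-onto (S′ , F′) tree with any? (λ x → orig x ∈? S′)
  ... | yes (x₀ , x₀∈) = let (x , valid , eq) = Restriction.extensionTree-onto tree x₀∈
                         in inj₁ x , valid , eq
  ... | no no-orig     = let (y , valid , eq) = InnerTree.segmentTree-onto tree (λ x x∈ → no-orig (x , x∈))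
                         in inj₂ y , valid , eq

  count-stretch-subtrees : (t : ℕ → ℕ → ℕ) → (∀ i j → Count (IsSubtree[_,_] G i j) (t i j)) →
    Count (IsSubtree H) (Σ< (suc m) (λ i → Σ< (suc m) (λ j → t i j * k ^ i * (suc k C 2) ^ j)) + m * (suc p C 2))
  count-stretch-subtrees t count-t =
    count-map treeOf (count-⊎ (count-decorated t count-t) count-segments) treeOf-subtree treeOf-injective treeOf-onto

proposition5p1 : {n m : ℕ} (G : Graph n m) (k : ℕ) → 1 ≤ k →
  (t : ℕ → ℕ → ℕ) → (∀ i j → Count (IsSubtree[_,_] G i j) (t i j)) →
  (tGk : ℕ) → Count (IsSubtree (stretch G k)) tGk →
  tGk ≡ Σ< (suc m) (λ i → Σ< (suc m) (λ j → t i j * k ^ i * (suc k C 2) ^ j))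
        + (k * (k ∸ 1) * m) / 2
proposition5p1 {m = m} G (suc p) _ t count-t tGk count-tGk = begin
  tGk                                   ≡⟨ count-unique count-tGk (Stretch.count-stretch-subtrees G p t count-t) ⟩
  extensions + m * (suc p C 2)          ≡⟨ cong (extensions +_) (sym (half-[1+p]*p*m p m)) ⟩
  extensions + (suc p * p * m) / 2      ∎
  where
  open ≡-Reasoning
  extensions = Σ< (suc m) (λ i → Σ< (suc m) (λ j → t i j * suc p ^ i * (suc (suc p) C 2) ^ j))
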